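{- For all integers $s \ge 1$: (i) $|EN_{s,1}(2143)| = 1$; (ii) $|EN_{s,2}(2143)| = 2^{s-1}$; (iii) $|EN_{s,3}(2143)| = F_{3s-1}$; (iv) $|EN_{s,4}(2143)| = \frac12\left(3\cdot 9^{s-1} + (-1)^s\right)$, where $F_n$ is the $n$th Fibonacci number, with $F_0=0$, $F_1=1$, $F_n=F_{n-1}+F_{n-2}$.
   Context: For positive integers $s,t$, write each $x \in [st]=\{1,\dots,st\}$ uniquely as $x=(j-1)t+r$ with $1\le j\le s$ and $1\le r\le t$. The poset $EN_{s,t}$ is $[st]$ with the partial order $(j-1)t+r \preceq (j'-1)t+r'$ if and only if $j'\le j$ and $r\le r'$. A linear extension of a poset $([n],\preceq)$ is a permutation $\pi=\pi(1)\cdots\pi(n)$ of $[n]$ (one-line notation) such that whenever $a\preceq b$ and $a\ne b$, $a$ appears before $b$ in $\pi$. A permutation $\pi$ avoids $\sigma$ if it has no subsequence with the same relative order as $\sigma$. $EN_{s,t}(\sigma)$ denotes the set of linear extensions of $EN_{s,t}$ avoiding $\sigma$. -}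

module Defs where

open import Data.Nat using (ℕ; zero; suc; _+_; _*_; _∸_; _≤_; _<_)
open import Data.Fin using (Fin; toℕ)
open import Data.List using (List; length; map; upTo; lookup)
open import Data.List.Relation.Unary.Unique.Propositional using (Unique)
open import Data.List.Membership.Propositional using (_∈_)
open import Data.List.Relation.Binary.Permutation.Propositional using (_↭_)
open import Data.Product using (Σ; ∃; _×_; _,_)
open import Relation.Binary.PropositionalEquality using (_≡_; _≢_)
open import Relation.Nullary using (¬_)
open import Function.Bundles using (_⇔_)

fib : ℕ → ℕ
fib zero = 0
fib (suc zero) = 1
fib (suc (suc n)) = fib (suc n) + fib n

range1 : ℕ → List ℕ
range1 n = map suc (upTo n)

Before : List ℕ → ℕ → ℕ → Set
Before π a b = Σ (Fin (length π)) λ i → Σ (Fin (length π)) λ k →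
  toℕ i < toℕ k × lookup π i ≡ a × lookup π k ≡ b

IsPerm : ℕ → List ℕ → Set
IsPerm n π = π ↭ range1 n

-- Element of EN_{s,t} with block index j (1 ≤ j ≤ s) and residue r (1 ≤ r ≤ t),
-- i.e. x = (j-1)t + r.
elt : ℕ → ℕ → ℕ → ℕ
elt t j r = (j ∸ 1) * t + r

IsLinExtEN : ℕ → ℕ → List ℕ → Set
IsLinExtEN s t π = IsPerm (s * t) π ×
  (∀ j r j' r' → 1 ≤ j → j ≤ s → 1 ≤ r → r ≤ t → 1 ≤ j' → j' ≤ s → 1 ≤ r' → r' ≤ t →
     j' ≤ j → r ≤ r' → elt t j r ≢ elt t j' r' →
     Before π (elt t j r) (elt t j' r'))

Contains2143 : List ℕ → Set
Contains2143 π = Σ (Fin (length π)) λ i → Σ (Fin (length π)) λ j →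
  Σ (Fin (length π)) λ k → Σ (Fin (length π)) λ l →
  toℕ i < toℕ j × toℕ j < toℕ k × toℕ k < toℕ l ×
  lookup π j < lookup π i × lookup π i < lookup π l × lookup π l < lookup π k

Avoids2143 : List ℕ → Set
Avoids2143 π = ¬ Contains2143 π

InEN2143 : ℕ → ℕ → List ℕ → Set
InEN2143 s t π = IsLinExtEN s t π × Avoids2143 π

CardEN2143 : ℕ → ℕ → ℕ → Set
CardEN2143 s t N = Σ (List (List ℕ)) λ L →
  Unique L × (∀ π → (π ∈ L) ⇔ InEN2143 s t π) × length L ≡ N

module Submission where

-- Put N = s t. The entries ≤ N of a linear extension π of EN_{s+1,t} form a linear extension π′ of
-- EN_{s,t}, which starts with a maximal run offset + 1, …, offset + a of entries of its top block.
-- When π avoids 2143, everything after the first entry of π′ that follows this run is ≤ N, so π is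
-- a shuffle of the new block N + 1, …, N + t with the run, followed by the rest of π′; the order of
-- EN forces the r-th new entry before the r-th run entry, a ballot condition on the shuffle word.
-- Conversely every such π avoids 2143: a 2143 needs a new entry, the new entries increase and
-- exceed all others, and the entries preceding them increase as well. The new run is the number of
-- leading new entries, so the numbers of avoiders with a given run obey a linear recurrence whose
-- coefficients count ballot words; for t ≤ 4 it is solved in closed form.

open import Defs

module Enumeration where

  open import Data.Bool using (Bool; true; false)
  open import Data.Empty using (⊥; ⊥-elim)
  open import Data.Fin using (Fin; toℕ) renaming (zero to fzero; suc to fsuc)
  open import Data.List
    using (List; []; _∷_; [_]; _++_; length; lookup; filter; head; map; applyUpTo; drop; concatMap; upTo)
  open import Data.List.Properties
    using ( length-++; length-map; map-cong; ++-assoc; ++-cancelʳ; ++-identityʳ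
          ; filter-all; filter-none; filter-++; filter-accept; filter-reject; ∷-injectiveˡ; ∷-injectiveʳ )
  open import Data.List.Membership.Propositional using (_∈_; _∉_)
  open import Data.List.Membership.Propositional.Properties
    using ( ∈-lookup; ∈-++⁺ˡ; ∈-++⁺ʳ; ∈-++⁻; ∈-map⁺; ∈-map⁻; ∈-∃++; ∈-upTo⁺
          ; ∈-concat⁺′; ∈-concat⁻′; ∈-filter⁺; ∈-filter⁻ )
  open import Data.List.Relation.Binary.Equality.Propositional using (≋⇒≡)
  open import Data.List.Relation.Binary.Permutation.Propositional
    using (_↭_; ↭-refl; ↭-sym; ↭-trans; ↭-reflexive; module PermutationReasoning)
  import Data.List.Relation.Binary.Permutation.Propositional as ↭
  open import Data.List.Relation.Binary.Permutation.Propositional.Properties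
    using (All-resp-↭; ∈-resp-↭; shift; ++⁺ʳ; ++⁺ˡ; ++-comm; filter-↭; ↭-length; ↭-empty-inv)
  open import Data.List.Relation.Binary.Sublist.Propositional
    using (_⊆_; []; _∷_; _∷ʳ_; ⊆-refl; ⊆-trans; from∈; to∈; minimum)
  open import Data.List.Relation.Binary.Sublist.Propositional.Properties using (Any-resp-⊆)
  import Data.List.Relation.Binary.Sublist.Propositional.Properties as Sublist
  open import Data.List.Relation.Unary.All using (All; []; _∷_)
  import Data.List.Relation.Unary.All as All
  import Data.List.Relation.Unary.All.Properties as AllProp
  open import Data.List.Relation.Unary.Any using (here; there)
  open import Data.List.Relation.Unary.Unique.Propositional using (Unique; []; _∷_)
  import Data.List.Relation.Unary.Unique.Propositional.Properties as Unique
  import Data.Maybe.Relation.Unary.All as Maybe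
  open import Data.Nat using (ℕ; zero; suc; _+_; _*_; _∸_; _≤_; _<_; z≤n; s≤s; _≤?_; _<?_; _≟_)
  open import Data.Nat.ListAction using (sum)
  open import Data.Nat.Properties
  open import Data.Product using (Σ; ∃; _×_; _,_; proj₁; proj₂)
  open import Data.Sum using (inj₁; inj₂)
  open import Function using (_∘′_; id; case_of_)
  open import Function.Bundles using (mk⇔)
  open import Level using (0ℓ)
  open import Relation.Binary.PropositionalEquality
    using (_≡_; _≢_; refl; sym; trans; cong; cong₂; subst; subst₂; module ≡-Reasoning)
  open import Relation.Nullary using (¬_; Dec; yes; no; does)
  open import Relation.Nullary.Decidable using (dec-true; dec-false)
  open import Relation.Unary using (Pred; Decidable)

  module _ {A : Set} where

    ⊆⇒increasingLookup : ∀ {xs ys : List A} → xs ⊆ ys →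
      Σ (Fin (length xs) → Fin (length ys)) λ f →
        (∀ i → lookup ys (f i) ≡ lookup xs i) × (∀ {i j} → toℕ i < toℕ j → toℕ (f i) < toℕ (f j))
    ⊆⇒increasingLookup [] = (λ ()) , (λ ()) , λ { {()} }
    ⊆⇒increasingLookup (y ∷ʳ p) with f , f-lookup , f-mono ← ⊆⇒increasingLookup p =
      fsuc ∘′ f , f-lookup , λ i<j → s≤s (f-mono i<j)
    ⊆⇒increasingLookup {x ∷ xs} {y ∷ ys} (refl ∷ p) with f , f-lookup , f-mono ← ⊆⇒increasingLookup p =
      g , g-lookup , g-mono
      where
      g : Fin (suc (length xs)) → Fin (suc (length ys))
      g fzero    = fzero
      g (fsuc i) = fsuc (f i)
      g-lookup : ∀ i → lookup (y ∷ ys) (g i) ≡ lookup (x ∷ xs) i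
      g-lookup fzero    = refl
      g-lookup (fsuc i) = f-lookup i
      g-mono : ∀ {i j} → toℕ i < toℕ j → toℕ (g i) < toℕ (g j)
      g-mono {fzero} {fsuc j} _ = s≤s z≤n
      g-mono {fsuc i} {fsuc j} (s≤s i<j) = s≤s (f-mono i<j)

    lookup₂-⊆ : ∀ (ys : List A) {i j : Fin (length ys)} → toℕ i < toℕ j →
      lookup ys i ∷ lookup ys j ∷ [] ⊆ ys
    lookup₂-⊆ (y ∷ ys) {fzero} {fsuc j} _ = refl ∷ from∈ (∈-lookup j)
    lookup₂-⊆ (y ∷ ys) {fsuc i} {fsuc j} (s≤s i<j) = y ∷ʳ lookup₂-⊆ ys i<j

    lookup₃-⊆ : ∀ (ys : List A) {i j k : Fin (length ys)} → toℕ i < toℕ j → toℕ j < toℕ k →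
      lookup ys i ∷ lookup ys j ∷ lookup ys k ∷ [] ⊆ ys
    lookup₃-⊆ (y ∷ ys) {fzero} {fsuc j} {fsuc k} _ (s≤s j<k) = refl ∷ lookup₂-⊆ ys j<k
    lookup₃-⊆ (y ∷ ys) {fsuc i} {fsuc j} {fsuc k} (s≤s i<j) (s≤s j<k) = y ∷ʳ lookup₃-⊆ ys i<j j<k

    lookup₄-⊆ : ∀ (ys : List A) {i j k l : Fin (length ys)} →
      toℕ i < toℕ j → toℕ j < toℕ k → toℕ k < toℕ l →
      lookup ys i ∷ lookup ys j ∷ lookup ys k ∷ lookup ys l ∷ [] ⊆ ys
    lookup₄-⊆ (y ∷ ys) {fzero} {fsuc j} {fsuc k} {fsuc l} _ (s≤s j<k) (s≤s k<l) =
      refl ∷ lookup₃-⊆ ys j<k k<l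
    lookup₄-⊆ (y ∷ ys) {fsuc i} {fsuc j} {fsuc k} {fsuc l} (s≤s i<j) (s≤s j<k) (s≤s k<l) =
      y ∷ʳ lookup₄-⊆ ys i<j j<k k<l

    head∉tail : ∀ {x : A} {xs} → Unique (x ∷ xs) → x ∉ xs
    head∉tail (x≢ ∷ _) x∈ = All.lookup x≢ x∈ refl

    Unique-resp-↭ : ∀ {xs ys : List A} → xs ↭ ys → Unique xs → Unique ys
    Unique-resp-↭ ↭.refl u = u
    Unique-resp-↭ (↭.prep x p) (x≢ ∷ u) = All-resp-↭ p x≢ ∷ Unique-resp-↭ p u
    Unique-resp-↭ (↭.swap x y p) ((x≢y ∷ x≢) ∷ y≢ ∷ u) =
      ((x≢y ∘′ sym) ∷ All-resp-↭ p y≢) ∷ All-resp-↭ p x≢ ∷ Unique-resp-↭ p u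
    Unique-resp-↭ (↭.trans p q) u = Unique-resp-↭ q (Unique-resp-↭ p u)

    Unique-++⁻ˡ : ∀ (σ : List A) {ρ} → Unique (σ ++ ρ) → Unique σ
    Unique-++⁻ˡ []      _          = []
    Unique-++⁻ˡ (x ∷ σ) (x≢ ∷ u) = AllProp.++⁻ˡ σ x≢ ∷ Unique-++⁻ˡ σ u

    Unique-++⇒∉ : ∀ {x : A} σ {ρ} → Unique (σ ++ ρ) → x ∈ σ → x ∉ ρ
    Unique-++⇒∉ (y ∷ σ) u       (here refl) x∈ρ = head∉tail u (∈-++⁺ʳ σ x∈ρ)
    Unique-++⇒∉ (y ∷ σ) (_ ∷ u) (there x∈σ) x∈ρ = Unique-++⇒∉ σ u x∈σ x∈ρ

    Unique-⊆-asym : ∀ {x y : A} {ys} → Unique ys → x ∷ y ∷ [] ⊆ ys → y ∷ x ∷ [] ⊆ ys → ⊥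
    Unique-⊆-asym (_ ∷ u) (_ ∷ʳ p) (_ ∷ʳ q) = Unique-⊆-asym u p q
    Unique-⊆-asym u       (_ ∷ʳ p) (refl ∷ q) = head∉tail u (Any-resp-⊆ p (there (here refl)))
    Unique-⊆-asym u       (refl ∷ p) (_ ∷ʳ q) = head∉tail u (Any-resp-⊆ q (there (here refl)))
    Unique-⊆-asym u       (refl ∷ p) (refl ∷ q) = head∉tail u (Any-resp-⊆ p (here refl))

    Unique-⊆-chain : ∀ {a b : A} {zs ys} → Unique ys →
      a ∷ b ∷ [] ⊆ ys → b ∷ zs ⊆ ys → a ∷ b ∷ zs ⊆ ys
    Unique-⊆-chain (_ ∷ u) (_ ∷ʳ p)   (_ ∷ʳ q)   = _ ∷ʳ Unique-⊆-chain u p q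
    Unique-⊆-chain u       (refl ∷ _) (_ ∷ʳ q)   = refl ∷ q
    Unique-⊆-chain u       (_ ∷ʳ p)   (refl ∷ _) = ⊥-elim (head∉tail u (Any-resp-⊆ p (there (here refl))))
    Unique-⊆-chain u       (refl ∷ p) (refl ∷ _) = ⊥-elim (head∉tail u (Any-resp-⊆ p (here refl)))

    Unique-⊆-trans : ∀ {a b c : A} {ys} → Unique ys →
      a ∷ b ∷ [] ⊆ ys → b ∷ c ∷ [] ⊆ ys → a ∷ c ∷ [] ⊆ ys
    Unique-⊆-trans u p q = ⊆-trans (refl ∷ _ ∷ʳ refl ∷ []) (Unique-⊆-chain u p q)

    ⊆-++⁻ˡ : ∀ {b : A} xs σ {ρ} → xs ++ [ b ] ⊆ σ ++ ρ → b ∉ ρ → xs ++ [ b ] ⊆ σ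
    ⊆-++⁻ˡ xs [] p b∉ρ = ⊥-elim (b∉ρ (Any-resp-⊆ p (∈-++⁺ʳ xs (here refl))))
    ⊆-++⁻ˡ [] (c ∷ σ) (_ ∷ʳ p) b∉ρ = c ∷ʳ ⊆-++⁻ˡ [] σ p b∉ρ
    ⊆-++⁻ˡ (x ∷ xs) (c ∷ σ) (_ ∷ʳ p) b∉ρ = c ∷ʳ ⊆-++⁻ˡ (x ∷ xs) σ p b∉ρ
    ⊆-++⁻ˡ [] (c ∷ σ) (refl ∷ p) b∉ρ = refl ∷ minimum σ
    ⊆-++⁻ˡ (x ∷ xs) (c ∷ σ) (refl ∷ p) b∉ρ = refl ∷ ⊆-++⁻ˡ xs σ p b∉ρ

    ++-∷-cancel : ∀ {x : A} α β γ δ → α ++ x ∷ β ≡ γ ++ x ∷ δ → x ∉ α → x ∉ γ →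
      α ≡ γ × β ≡ δ
    ++-∷-cancel [] β [] δ e _ _ = refl , ∷-injectiveʳ e
    ++-∷-cancel [] β (c ∷ γ) δ e _ x∉γ = ⊥-elim (x∉γ (here (∷-injectiveˡ e)))
    ++-∷-cancel (c ∷ α) β [] δ e x∉α _ = ⊥-elim (x∉α (here (sym (∷-injectiveˡ e))))
    ++-∷-cancel (c ∷ α) β (c′ ∷ γ) δ e x∉α x∉γ
      with α≡γ , β≡δ ← ++-∷-cancel α β γ δ (∷-injectiveʳ e) (x∉α ∘′ there) (x∉γ ∘′ there) =
      cong₂ _∷_ (∷-injectiveˡ e) α≡γ , β≡δ

    module _ {P : Pred A 0ℓ} (P? : Decidable P) where

      ⊆-filter⁺ : ∀ {xs ys} → xs ⊆ ys → All P xs → xs ⊆ filter P? ys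
      ⊆-filter⁺ p all = subst (_⊆ _) (filter-all P? all) (Sublist.filter⁺ P? P? (λ { refl Px → Px }) p)

  module _ {A B : Set} {f : A → B} where

    map-unique : ∀ {xs} → Unique xs → (∀ {x x′} → x ∈ xs → x′ ∈ xs → f x ≡ f x′ → x ≡ x′) →
      Unique (map f xs)
    map-unique {[]}     _ _ = []
    map-unique {x ∷ xs} u@(_ ∷ uxs) f-injective =
      All.tabulate (λ y∈ fx≡y → let x′ , x′∈ , y≡fx′ = ∈-map⁻ f y∈ in
        head∉tail u (subst (_∈ xs) (sym (f-injective (here refl) (there x′∈) (trans fx≡y y≡fx′))) x′∈))
      ∷ map-unique uxs λ x∈ x′∈ → f-injective (there x∈) (there x′∈)

  module _ {A B : Set} {f : A → List B} where

    ∈-concatMap⁺ : ∀ {x xs y} → x ∈ xs → y ∈ f x → y ∈ concatMap f xs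
    ∈-concatMap⁺ x∈ y∈ = ∈-concat⁺′ y∈ (∈-map⁺ f x∈)

    ∈-concatMap⁻ : ∀ xs {y} → y ∈ concatMap f xs → ∃ λ x → x ∈ xs × y ∈ f x
    ∈-concatMap⁻ xs y∈ with ys , y∈ys , ys∈ ← ∈-concat⁻′ (map f xs) y∈
      with x , x∈ , refl ← ∈-map⁻ f ys∈ =
      x , x∈ , y∈ys

    length-concatMap : ∀ xs → length (concatMap f xs) ≡ sum (map (length ∘′ f) xs)
    length-concatMap []       = refl
    length-concatMap (x ∷ xs) = trans (length-++ (f x)) (cong (_+_ (length (f x))) (length-concatMap xs))

    concatMap-unique : ∀ {xs} → Unique xs → (∀ {x} → x ∈ xs → Unique (f x)) →
      (∀ {x x′ y} → x ∈ xs → x′ ∈ xs → y ∈ f x → y ∈ f x′ → x ≡ x′) → Unique (concatMap f xs)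
    concatMap-unique {[]}     _ _ _ = []
    concatMap-unique {x ∷ xs} u@(_ ∷ uxs) f-unique f-disjoint =
      Unique.++⁺ (f-unique (here refl))
                 (concatMap-unique uxs (f-unique ∘′ there) λ x∈ x′∈ → f-disjoint (there x∈) (there x′∈))
                 λ (y∈ , y∈′) → let x′ , x′∈ , y∈x′ = ∈-concatMap⁻ xs y∈′ in
                   head∉tail u (subst (_∈ xs) (sym (f-disjoint (here refl) (there x′∈) y∈ y∈x′)) x′∈)

  no-member⇒length≡0 : ∀ {A : Set} (xs : List A) → (∀ {x} → x ∈ xs → ⊥) → length xs ≡ 0
  no-member⇒length≡0 []      _    = refl
  no-member⇒length≡0 (x ∷ _) x∉xs = ⊥-elim (x∉xs (here refl))

  sum-map-const : ∀ {A : Set} (xs : List A) k → sum (map (λ _ → k) xs) ≡ length xs * k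
  sum-map-const []       k = refl
  sum-map-const (x ∷ xs) k = cong (_+_ k) (sum-map-const xs k)

  -- Patterns as sublists

  Before⇒⊆ : ∀ {π a b} → Before π a b → a ∷ b ∷ [] ⊆ π
  Before⇒⊆ {π} (i , k , i<k , refl , refl) = lookup₂-⊆ π i<k

  ⊆⇒Before : ∀ {π a b} → a ∷ b ∷ [] ⊆ π → Before π a b
  ⊆⇒Before p with f , f-lookup , f-mono ← ⊆⇒increasingLookup p =
    f fzero , f (fsuc fzero) , f-mono (s≤s z≤n) , f-lookup fzero , f-lookup (fsuc fzero)

  Pattern2143 : ℕ → ℕ → ℕ → ℕ → Set
  Pattern2143 x y z w = y < x × x < w × w < z

  record Occurrence2143 (π : List ℕ) : Set where
    constructor occurrence
    field
      {x y z w} : ℕ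
      sublist : x ∷ y ∷ z ∷ w ∷ [] ⊆ π
      is2143 : Pattern2143 x y z w

  Contains⇒Occurrence : ∀ {π} → Contains2143 π → Occurrence2143 π
  Contains⇒Occurrence {π} (i , j , k , l , i<j , j<k , k<l , is2143) =
    occurrence (lookup₄-⊆ π i<j j<k k<l) is2143

  Occurrence⇒Contains : ∀ {π} → Occurrence2143 π → Contains2143 π
  Occurrence⇒Contains (occurrence p is2143) with f , f-lookup , f-mono ← ⊆⇒increasingLookup p
    rewrite sym (f-lookup fzero) | sym (f-lookup (fsuc fzero))
          | sym (f-lookup (fsuc (fsuc fzero))) | sym (f-lookup (fsuc (fsuc (fsuc fzero)))) =
    _ , _ , _ , _ , f-mono (s≤s z≤n) , f-mono (s≤s (s≤s z≤n)) , f-mono (s≤s (s≤s (s≤s z≤n))) , is2143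

  Avoids⇒noOccurrence : ∀ {π} → Avoids2143 π → ¬ Occurrence2143 π
  Avoids⇒noOccurrence avoids = avoids ∘′ Occurrence⇒Contains

  Avoids-⊆ : ∀ {π π′} → π ⊆ π′ → Avoids2143 π′ → Avoids2143 π
  Avoids-⊆ π⊆π′ avoids c with occurrence p is2143 ← Contains⇒Occurrence c =
    Avoids⇒noOccurrence avoids (occurrence (⊆-trans p π⊆π′) is2143)

  -- The entries of an occurrence exceeding N are its largest ones: none (ruled out by the
  -- filtered list), only z (ruled out by the third hypothesis) or at least z and w (by the second).
  Avoids-threshold : ∀ N π → Avoids2143 (filter (_≤? N) π) →
    (∀ {u v} → u ∷ v ∷ [] ⊆ π → N < u → N < v → u < v) →
    (∀ {u v b} → u ∷ v ∷ b ∷ [] ⊆ π → u ≤ N → v ≤ N → N < b → u < v) →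
    Avoids2143 π
  Avoids-threshold N π avoids large-increasing small-increasing c
    with occurrence {x} {y} {z} {w} p (y<x , x<w , w<z) ← Contains⇒Occurrence c | w ≤? N
  ... | no w≰N = <-asym w<z (large-increasing (⊆-trans (_ ∷ʳ _ ∷ʳ refl ∷ refl ∷ []) p)
                   (<-trans (≰⇒> w≰N) w<z) (≰⇒> w≰N))
  ... | yes w≤N = case-z (z ≤? N)
    where
    x≤N : x ≤ N
    x≤N = <⇒≤ (<-≤-trans x<w w≤N)
    y≤N : y ≤ N
    y≤N = <⇒≤ (<-≤-trans (<-trans y<x x<w) w≤N)
    case-z : Dec (z ≤ N) → ⊥
    case-z (yes z≤N) = Avoids⇒noOccurrence avoids
      (occurrence (⊆-filter⁺ (_≤? N) p (x≤N ∷ y≤N ∷ z≤N ∷ w≤N ∷ [])) (y<x , x<w , w<z))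
    case-z (no z≰N) =
      <-asym y<x (small-increasing (⊆-trans (refl ∷ refl ∷ refl ∷ _ ∷ʳ []) p) x≤N y≤N (≰⇒> z≰N))

  segment : ℕ → ℕ → List ℕ
  segment M zero = []
  segment M (suc n) = suc M ∷ segment (suc M) n

  map-suc-applyUpTo : ∀ M n (f : ℕ → ℕ) → (∀ k → f k ≡ M + k) →
    map suc (applyUpTo f n) ≡ segment M n
  map-suc-applyUpTo M zero    f f≗ = refl
  map-suc-applyUpTo M (suc n) f f≗ = cong₂ _∷_ (cong suc (trans (f≗ 0) (+-identityʳ M)))
    (map-suc-applyUpTo (suc M) n (f ∘′ suc) λ k → trans (f≗ (suc k)) (+-suc M k))

  range1≡segment : ∀ n → range1 n ≡ segment 0 n
  range1≡segment n = map-suc-applyUpTo 0 n id λ _ → refl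

  drop-segment : ∀ M n ρ → drop n (segment M n ++ ρ) ≡ ρ
  drop-segment M zero    ρ = refl
  drop-segment M (suc n) ρ = drop-segment (suc M) n ρ

  segment-++ : ∀ M m n → segment M (m + n) ≡ segment M m ++ segment (M + m) n
  segment-++ M zero    n = cong (λ K → segment K n) (sym (+-identityʳ M))
  segment-++ M (suc m) n = cong (suc M ∷_)
    (trans (segment-++ (suc M) m n) (cong (λ K → segment (suc M) m ++ segment K n) (sym (+-suc M m))))

  ∈-segment⁻ : ∀ {M n x} → x ∈ segment M n → M < x × x ≤ M + n
  ∈-segment⁻ {M} {suc n} (here refl) = ≤-refl , ≤-trans (s≤s (m≤m+n M n)) (≤-reflexive (sym (+-suc M n)))
  ∈-segment⁻ {M} {suc n} (there x∈) with M<x , x≤ ← ∈-segment⁻ {suc M} {n} x∈ =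
    <-trans (n<1+n M) M<x , ≤-trans x≤ (≤-reflexive (sym (+-suc M n)))

  ∈-segment⁺ : ∀ {M n x} → M < x → x ≤ M + n → x ∈ segment M n
  ∈-segment⁺ {M} {zero}  M<x x≤ = ⊥-elim (<⇒≱ M<x (≤-trans x≤ (≤-reflexive (+-identityʳ M))))
  ∈-segment⁺ {M} {suc n} {x} M<x x≤ with suc M ≟ x
  ... | yes refl = here refl
  ... | no M+1≢x = there (∈-segment⁺ (≤∧≢⇒< M<x M+1≢x) (≤-trans x≤ (≤-reflexive (+-suc M n))))

  segment-unique : ∀ M n → Unique (segment M n)
  segment-unique M zero    = []
  segment-unique M (suc n) =
    All.tabulate (λ x∈ M+1≡x → <-irrefl M+1≡x (proj₁ (∈-segment⁻ x∈))) ∷ segment-unique (suc M) n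

  segment-⊆⇒< : ∀ {M n u v} → u ∷ v ∷ [] ⊆ segment M n → u < v
  segment-⊆⇒< {M} {suc n} (_ ∷ʳ p)   = segment-⊆⇒< p
  segment-⊆⇒< {M} {suc n} (refl ∷ p) = proj₁ (∈-segment⁻ (to∈ p))

  <⇒segment-⊆ : ∀ {M n u v} → M < u → u < v → v ≤ M + n → u ∷ v ∷ [] ⊆ segment M n
  <⇒segment-⊆ {M} {zero}  M<u u<v v≤ =
    ⊥-elim (<⇒≱ (<-trans M<u u<v) (≤-trans v≤ (≤-reflexive (+-identityʳ M))))
  <⇒segment-⊆ {M} {suc n} {u} M<u u<v v≤ with suc M ≟ u
  ... | yes refl = refl ∷ from∈ (∈-segment⁺ u<v (≤-trans v≤ (≤-reflexive (+-suc M n))))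
  ... | no M+1≢u =
    suc M ∷ʳ <⇒segment-⊆ (≤∧≢⇒< M<u M+1≢u) u<v (≤-trans v≤ (≤-reflexive (+-suc M n)))

  segment-++-injective : ∀ {K} M a b {ρ ρ′} → K ≤ M →
    Maybe.All (_≤ K) (head ρ) → Maybe.All (_≤ K) (head ρ′) →
    segment M a ++ ρ ≡ segment M b ++ ρ′ → a ≡ b
  segment-++-injective M zero    zero    _   _         _         _  = refl
  segment-++-injective M zero    (suc b) {_ ∷ _} K≤M (Maybe.just x≤K) _ eq =
    ⊥-elim (<⇒≱ (s≤s K≤M) (≤-trans (≤-reflexive (sym (∷-injectiveˡ eq))) x≤K))
  segment-++-injective M (suc a) zero {ρ′ = _ ∷ _} K≤M _ (Maybe.just x≤K) eq =
    ⊥-elim (<⇒≱ (s≤s K≤M) (≤-trans (≤-reflexive (∷-injectiveˡ eq)) x≤K))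
  segment-++-injective M (suc a) (suc b) K≤M ρ-head ρ′-head eq =
    cong suc (segment-++-injective (suc M) a b (≤-trans K≤M (n≤1+n M)) ρ-head ρ′-head (∷-injectiveʳ eq))

  Unique-segment-⊆ : ∀ {ys} M n → Unique ys → suc M ∈ ys →
    (∀ r → 1 ≤ r → suc r ≤ n → M + r ∷ M + suc r ∷ [] ⊆ ys) → segment M n ⊆ ys
  Unique-segment-⊆ M zero          u M+1∈ consecutive = minimum _
  Unique-segment-⊆ M (suc zero)    u M+1∈ consecutive = from∈ M+1∈
  Unique-segment-⊆ {ys} M (suc (suc n)) u M+1∈ consecutive =
    Unique-⊆-chain u first (Unique-segment-⊆ (suc M) (suc n) u (Any-resp-⊆ first (there (here refl))) next)
    where
    first : suc M ∷ suc (suc M) ∷ [] ⊆ ys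
    first = subst₂ (λ x y → x ∷ y ∷ [] ⊆ ys) (+-comm M 1) (+-comm M 2)
              (consecutive 1 ≤-refl (s≤s (s≤s z≤n)))
    next : ∀ r → 1 ≤ r → suc r ≤ suc n → suc M + r ∷ suc M + suc r ∷ [] ⊆ ys
    next r _ r<n = subst₂ (λ x y → x ∷ y ∷ [] ⊆ ys) (+-suc M r) (+-suc M (suc r))
                     (consecutive (suc r) (s≤s z≤n) (s≤s r<n))

  -- Ballot words and shuffles

  -- true and false mark large and small entries; d is the current lead of trues over falses.
  data Ballot : ℕ → ℕ → ℕ → List Bool → Set where
    []     : ∀ {d} → Ballot 0 0 d []
    true∷  : ∀ {i j d w} → Ballot i j (suc d) w → Ballot (suc i) j d (true ∷ w)
    false∷ : ∀ {i j d w} → Ballot i j d w → Ballot i (suc j) (suc d) (false ∷ w)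

  ballots : ℕ → ℕ → ℕ → List (List Bool)
  ballots zero    zero    d       = [ [] ]
  ballots zero    (suc j) zero    = []
  ballots zero    (suc j) (suc d) = map (false ∷_) (ballots zero j d)
  ballots (suc i) zero    d       = map (true ∷_) (ballots i zero (suc d))
  ballots (suc i) (suc j) zero    = map (true ∷_) (ballots i (suc j) 1)
  ballots (suc i) (suc j) (suc d) =
    map (true ∷_) (ballots i (suc j) (suc (suc d))) ++ map (false ∷_) (ballots (suc i) j d)

  ∈-ballots⁻ : ∀ i j d {w} → w ∈ ballots i j d → Ballot i j d w
  ∈-ballots⁻ zero    zero    d       (here refl) = []
  ∈-ballots⁻ zero    (suc j) (suc d) w∈ with w , w∈ , refl ← ∈-map⁻ (false ∷_) w∈ =
    false∷ (∈-ballots⁻ zero j d w∈)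
  ∈-ballots⁻ (suc i) zero    d       w∈ with w , w∈ , refl ← ∈-map⁻ (true ∷_) w∈ =
    true∷ (∈-ballots⁻ i zero (suc d) w∈)
  ∈-ballots⁻ (suc i) (suc j) zero    w∈ with w , w∈ , refl ← ∈-map⁻ (true ∷_) w∈ =
    true∷ (∈-ballots⁻ i (suc j) 1 w∈)
  ∈-ballots⁻ (suc i) (suc j) (suc d) w∈ with ∈-++⁻ (map (true ∷_) (ballots i (suc j) (suc (suc d)))) w∈
  ... | inj₁ w∈ with w , w∈ , refl ← ∈-map⁻ (true ∷_) w∈ =
    true∷ (∈-ballots⁻ i (suc j) (suc (suc d)) w∈)
  ... | inj₂ w∈ with w , w∈ , refl ← ∈-map⁻ (false ∷_) w∈ =
    false∷ (∈-ballots⁻ (suc i) j d w∈)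

  ∈-ballots⁺ : ∀ {i j d w} → Ballot i j d w → w ∈ ballots i j d
  ∈-ballots⁺ [] = here refl
  ∈-ballots⁺ (true∷ {j = zero} b) = ∈-map⁺ (true ∷_) (∈-ballots⁺ b)
  ∈-ballots⁺ (true∷ {j = suc j} {zero} b) = ∈-map⁺ (true ∷_) (∈-ballots⁺ b)
  ∈-ballots⁺ (true∷ {j = suc j} {suc d} b) = ∈-++⁺ˡ (∈-map⁺ (true ∷_) (∈-ballots⁺ b))
  ∈-ballots⁺ (false∷ {zero} b) = ∈-map⁺ (false ∷_) (∈-ballots⁺ b)
  ∈-ballots⁺ (false∷ {suc i} {j} {d} b) =
    ∈-++⁺ʳ (map (true ∷_) (ballots i (suc j) (suc (suc d)))) (∈-map⁺ (false ∷_) (∈-ballots⁺ b))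

  map-∷-unique : ∀ b {ws : List (List Bool)} → Unique ws → Unique (map (b ∷_) ws)
  map-∷-unique b = Unique.map⁺ ∷-injectiveʳ

  ballots-unique : ∀ i j d → Unique (ballots i j d)
  ballots-unique zero    zero    d       = [] ∷ []
  ballots-unique zero    (suc j) zero    = []
  ballots-unique zero    (suc j) (suc d) = map-∷-unique false (ballots-unique zero j d)
  ballots-unique (suc i) zero    d       = map-∷-unique true (ballots-unique i zero (suc d))
  ballots-unique (suc i) (suc j) zero    = map-∷-unique true (ballots-unique i (suc j) 1)
  ballots-unique (suc i) (suc j) (suc d) =
    Unique.++⁺ (map-∷-unique true (ballots-unique i (suc j) (suc (suc d))))
               (map-∷-unique false (ballots-unique (suc i) j d)) disjoint
    where
    disjoint : ∀ {v} → v ∈ map (true ∷_) (ballots i (suc j) (suc (suc d))) ×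
                       v ∈ map (false ∷_) (ballots (suc i) j d) → ⊥
    disjoint (v∈ , v∈′) with _ , _ , refl ← ∈-map⁻ (true ∷_) v∈ | _ , _ , () ← ∈-map⁻ (false ∷_) v∈′

  leadingTrues : List Bool → ℕ
  leadingTrues (true ∷ w) = suc (leadingTrues w)
  leadingTrues _          = 0

  leadingTrues-≤ : ∀ {i j d w} → Ballot i j d w → leadingTrues w ≤ i
  leadingTrues-≤ []         = z≤n
  leadingTrues-≤ (true∷ b)  = s≤s (leadingTrues-≤ b)
  leadingTrues-≤ (false∷ b) = z≤n

  leadingTrues-pos : ∀ {i j w} → Ballot (suc i) j 0 w → 1 ≤ leadingTrues w
  leadingTrues-pos (true∷ b) = s≤s z≤n

  shuffle : List Bool → List ℕ → List ℕ → List ℕ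
  shuffle []          _        _        = []
  shuffle (true ∷ w)  []       ss       = []
  shuffle (true ∷ w)  (l ∷ ls) ss       = l ∷ shuffle w ls ss
  shuffle (false ∷ w) ls       []       = []
  shuffle (false ∷ w) ls       (s ∷ ss) = s ∷ shuffle w ls ss

  shuffle-↭ : ∀ {i j d w} → Ballot i j d w → ∀ P Q →
    shuffle w (segment P i) (segment Q j) ↭ segment P i ++ segment Q j
  shuffle-↭ []         P Q = ↭-refl
  shuffle-↭ (true∷ b)  P Q = ↭.prep (suc P) (shuffle-↭ b (suc P) Q)
  shuffle-↭ {i} (false∷ {j = j} b) P Q =
    ↭-trans (↭.prep (suc Q) (shuffle-↭ b P (suc Q))) (↭-sym (shift (suc Q) (segment P i) (segment (suc Q) j)))

  ∈-shuffle⁺ : ∀ {i j d w} → Ballot i j d w → ∀ P Q {x} → x ∈ segment Q j →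
    x ∈ shuffle w (segment P i) (segment Q j)
  ∈-shuffle⁺ {i} b P Q x∈ = ∈-resp-↭ (↭-sym (shuffle-↭ b P Q)) (∈-++⁺ʳ (segment P i) x∈)

  shuffle-ballot : ∀ {i j d w} → Ballot i j d w → ∀ P Q k → 1 ≤ k → d + k ≤ j →
    P + k ∷ Q + (d + k) ∷ [] ⊆ shuffle w (segment P i) (segment Q j)
  shuffle-ballot [] P Q k 1≤k d+k≤0 = ⊥-elim (<⇒≱ (≤-trans 1≤k (m≤n+m k _)) d+k≤0)
  shuffle-ballot {d = d} (true∷ b) P Q (suc zero) _ d+1≤j rewrite +-comm P 1 =
    refl ∷ from∈ (∈-shuffle⁺ b (suc P) Q
                   (∈-segment⁺ (m<m+n Q (≤-trans (s≤s z≤n) (≤-reflexive (sym (+-comm d 1)))))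
                               (+-monoʳ-≤ Q d+1≤j)))
  shuffle-ballot {d = d} (true∷ b) P Q (suc (suc k)) _ d+k+2≤j
    with shuffle-ballot b (suc P) Q (suc k) (s≤s z≤n) (≤-trans (≤-reflexive (sym (+-suc d (suc k)))) d+k+2≤j)
  ... | p rewrite +-suc P (suc k) | sym (+-suc d (suc k)) = suc P ∷ʳ p
  shuffle-ballot {d = suc d} (false∷ b) P Q k 1≤k (s≤s d+k≤j)
    with shuffle-ballot b P (suc Q) k 1≤k d+k≤j
  ... | p rewrite sym (+-suc Q (d + k)) = suc Q ∷ʳ p

  module Threshold (N : ℕ) where

    private
      shift-bound : ∀ Q j → Q + suc j ≤ N → suc Q + j ≤ N
      shift-bound Q j = ≤-trans (≤-reflexive (sym (+-suc Q j)))

      head-bound : ∀ Q j → Q + suc j ≤ N → suc Q ≤ N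
      head-bound Q j bound = ≤-trans (s≤s (m≤m+n Q j)) (shift-bound Q j bound)

    filter-small-shuffle : ∀ {i j d w} → Ballot i j d w → ∀ P Q → N ≤ P → Q + j ≤ N →
      filter (_≤? N) (shuffle w (segment P i) (segment Q j)) ≡ segment Q j
    filter-small-shuffle [] P Q _ _ = refl
    filter-small-shuffle (true∷ b) P Q N≤P bound =
      trans (filter-reject (_≤? N) (<⇒≱ (s≤s N≤P)))
            (filter-small-shuffle b (suc P) Q (≤-trans N≤P (n≤1+n P)) bound)
    filter-small-shuffle (false∷ {j = j} b) P Q N≤P bound =
      trans (filter-accept (_≤? N) (head-bound Q j bound))
            (cong (suc Q ∷_) (filter-small-shuffle b P (suc Q) N≤P (shift-bound Q j bound)))

    filter-large-shuffle : ∀ {i j d w} → Ballot i j d w → ∀ P Q → N ≤ P → Q + j ≤ N →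
      filter (N <?_) (shuffle w (segment P i) (segment Q j)) ≡ segment P i
    filter-large-shuffle [] P Q _ _ = refl
    filter-large-shuffle (true∷ b) P Q N≤P bound =
      trans (filter-accept (N <?_) (s≤s N≤P))
            (cong (suc P ∷_) (filter-large-shuffle b (suc P) Q (≤-trans N≤P (n≤1+n P)) bound))
    filter-large-shuffle (false∷ {j = j} b) P Q N≤P bound =
      trans (filter-reject (N <?_) (≤⇒≯ (head-bound Q j bound)))
            (filter-large-shuffle b P (suc Q) N≤P (shift-bound Q j bound))

    shuffle-word : ∀ {i j d w} → Ballot i j d w → ∀ P Q → N ≤ P → Q + j ≤ N →
      map (λ x → does (N <? x)) (shuffle w (segment P i) (segment Q j)) ≡ w
    shuffle-word [] P Q _ _ = refl
    shuffle-word (true∷ b) P Q N≤P bound =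
      cong₂ _∷_ (dec-true (N <? suc P) (s≤s N≤P)) (shuffle-word b (suc P) Q (≤-trans N≤P (n≤1+n P)) bound)
    shuffle-word (false∷ {j = j} b) P Q N≤P bound =
      cong₂ _∷_ (dec-false (N <? suc Q) (≤⇒≯ (head-bound Q j bound)))
                (shuffle-word b P (suc Q) N≤P (shift-bound Q j bound))

    shuffle-injective : ∀ {i j d w w′} → Ballot i j d w → Ballot i j d w′ →
      ∀ P Q → N ≤ P → Q + j ≤ N →
      shuffle w (segment P i) (segment Q j) ≡ shuffle w′ (segment P i) (segment Q j) → w ≡ w′
    shuffle-injective b b′ P Q N≤P bound eq =
      trans (sym (shuffle-word b P Q N≤P bound))
            (trans (cong (map (λ x → does (N <? x))) eq) (shuffle-word b′ P Q N≤P bound))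

    shuffle-++-leadingTrues : ∀ {i j d w} → Ballot i j d w → ∀ P Q ρ → Q + j ≤ N →
      Maybe.All (_≤ N) (head ρ) →
      ∃ λ ρ′ → shuffle w (segment P i) (segment Q j) ++ ρ ≡ segment P (leadingTrues w) ++ ρ′
             × Maybe.All (_≤ N) (head ρ′)
    shuffle-++-leadingTrues [] P Q ρ _ ρ-head = ρ , refl , ρ-head
    shuffle-++-leadingTrues (true∷ b) P Q ρ bound ρ-head
      with ρ′ , eq , ρ′-head ← shuffle-++-leadingTrues b (suc P) Q ρ bound ρ-head =
      ρ′ , cong (suc P ∷_) eq , ρ′-head
    shuffle-++-leadingTrues (false∷ {j = j} b) P Q ρ bound ρ-head =
      _ , refl , Maybe.just (head-bound Q j bound)

    private
      ∷≢[] : ∀ {x : ℕ} {xs} → _≢_ {A = List ℕ} (x ∷ xs) []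
      ∷≢[] ()

      large≢small : ∀ {P k x} → N ≤ P → 1 ≤ k → x ≤ N → P + k ≢ x
      large≢small {P} N≤P 1≤k x≤N refl =
        <⇒≱ (≤-trans (s≤s N≤P) (≤-trans (≤-reflexive (+-comm 1 P)) (+-monoʳ-≤ P 1≤k))) x≤N

      +-suc-≢ : ∀ P {k} → 1 ≤ k → P + suc k ≢ suc P
      +-suc-≢ P {suc k} _ eq = m+1+n≢m P (suc-injective (trans (sym (+-suc P (suc k))) eq))

    shuffle-complete : ∀ i j d P Q σ → N ≤ P → Q + j ≤ N → Unique σ →
      filter (_≤? N) σ ≡ segment Q j → filter (N <?_) σ ≡ segment P i →
      (∀ k → 1 ≤ k → d + k ≤ j → P + k ∷ Q + (d + k) ∷ [] ⊆ σ) →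
      ∃ λ w → Ballot i j d w × shuffle w (segment P i) (segment Q j) ≡ σ
    shuffle-complete zero    zero    d P Q [] _ _ _ _  _  _ = [] , [] , refl
    shuffle-complete (suc i) j       d P Q [] _ _ _ _  () _
    shuffle-complete zero    (suc j) d P Q [] _ _ _ () _  _
    shuffle-complete i j d P Q (x ∷ σ) N≤P bound u@(_ ∷ uσ) small large ballot with x ≤? N
    ... | yes x≤N = small-head j d bound (trans (sym (filter-accept (_≤? N) x≤N)) small)
                      (trans (sym (filter-reject (N <?_) (≤⇒≯ x≤N))) large) ballot
      where
      small-head : ∀ j d → Q + j ≤ N →
        x ∷ filter (_≤? N) σ ≡ segment Q j → filter (N <?_) σ ≡ segment P i →
        (∀ k → 1 ≤ k → d + k ≤ j → P + k ∷ Q + (d + k) ∷ [] ⊆ x ∷ σ) →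
        ∃ λ w → Ballot i j d w × shuffle w (segment P i) (segment Q j) ≡ x ∷ σ
      small-head zero    d       _     eq _     _      = ⊥-elim (∷≢[] eq)
      small-head (suc j) zero    _     eq large ballot with p ← ballot 1 ≤-refl (s≤s z≤n) rewrite +-comm Q 1 =
        ⊥-elim (head∉tail u (subst (_∈ σ) (sym (∷-injectiveˡ eq))
          (Any-resp-⊆ (Sublist.∷ʳ⁻ (large≢small N≤P ≤-refl x≤N) p) (there (here refl)))))
      small-head (suc j) (suc d) bound eq large ballot
        with w , b , eq′ ← shuffle-complete i j d P (suc Q) σ N≤P (shift-bound Q j bound) uσ
                             (∷-injectiveʳ eq) large
                             (λ k 1≤k d+k≤j → subst (λ y → P + k ∷ y ∷ [] ⊆ σ) (+-suc Q (d + k))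
                               (Sublist.∷ʳ⁻ (large≢small N≤P 1≤k x≤N) (ballot k 1≤k (s≤s d+k≤j)))) =
        false ∷ w , false∷ b , cong₂ _∷_ (sym (∷-injectiveˡ eq)) eq′
    ... | no x≰N = large-head i (trans (sym (filter-reject (_≤? N) x≰N)) small)
                     (trans (sym (filter-accept (N <?_) (≰⇒> x≰N))) large)
      where
      large-head : ∀ i → filter (_≤? N) σ ≡ segment Q j → x ∷ filter (N <?_) σ ≡ segment P i →
        ∃ λ w → Ballot i j d w × shuffle w (segment P i) (segment Q j) ≡ x ∷ σ
      large-head zero    _     eq = ⊥-elim (∷≢[] eq)
      large-head (suc i) small eq
        with w , b , eq′ ← shuffle-complete i j (suc d) (suc P) Q σ (≤-trans N≤P (n≤1+n P)) bound uσ small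
                             (∷-injectiveʳ eq)
                             (λ k 1≤k d+k≤j → subst₂ (λ y z → y ∷ Q + z ∷ [] ⊆ σ) (+-suc P k) (+-suc d k)
                               (Sublist.∷ʳ⁻ (λ e → +-suc-≢ P 1≤k (trans e (∷-injectiveˡ eq)))
                                 (ballot (suc k) (s≤s z≤n) (≤-trans (≤-reflexive (+-suc d k)) d+k≤j)))) =
        true ∷ w , true∷ b , cong₂ _∷_ (sym (∷-injectiveˡ eq)) eq′

  range1-+ : ∀ m n → range1 (m + n) ≡ range1 m ++ segment m n
  range1-+ m n = trans (range1≡segment (m + n))
    (trans (segment-++ 0 m n) (cong (_++ segment m n) (sym (range1≡segment m))))

  ∈-IsPerm⁻ : ∀ {n π x} → IsPerm n π → x ∈ π → 1 ≤ x × x ≤ n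
  ∈-IsPerm⁻ {n} π↭ x∈ = ∈-segment⁻ (subst (_ ∈_) (range1≡segment n) (∈-resp-↭ π↭ x∈))

  ∈-IsPerm⁺ : ∀ {n π x} → IsPerm n π → 1 ≤ x → x ≤ n → x ∈ π
  ∈-IsPerm⁺ {n} π↭ 1≤x x≤n =
    ∈-resp-↭ (↭-sym π↭) (subst (_ ∈_) (sym (range1≡segment n)) (∈-segment⁺ 1≤x x≤n))

  IsPerm-unique : ∀ {n π} → IsPerm n π → Unique π
  IsPerm-unique {n} π↭ =
    Unique-resp-↭ (↭-sym π↭) (subst Unique (sym (range1≡segment n)) (segment-unique 0 n))

  -- The 2143-avoiding linear extensions of EN_{s,t}, by the run they start with

  module Extensions (t₀ : ℕ) where

    t : ℕ
    t = suc t₀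

    -- Block j of EN_{s,t} is the segment offset j + 1, …, offset j + t.
    offset : ℕ → ℕ
    offset j = (j ∸ 1) * t

    offset-+-t : ∀ s → 1 ≤ s → offset s + t ≡ s * t
    offset-+-t (suc s) _ = +-comm (s * t) t

    offset-≤ : ∀ s → offset s ≤ s * t
    offset-≤ zero    = z≤n
    offset-≤ (suc s) = m≤n+m (s * t) t

    offset-< : ∀ s → 1 ≤ s → offset s < s * t
    offset-< s 1≤s = subst (offset s <_) (offset-+-t s 1≤s) (m<m+n (offset s) (s≤s z≤n))

    elt-≤ : ∀ {s j r} → 1 ≤ j → j ≤ s → r ≤ t → elt t j r ≤ s * t
    elt-≤ {s} {suc j} {r} _ j<s r≤t =
      ≤-trans (+-monoʳ-≤ (j * t) r≤t) (≤-trans (≤-reflexive (+-comm (j * t) t)) (*-monoˡ-≤ t j<s))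

    RespectsOrder : ℕ → List ℕ → Set
    RespectsOrder s π = ∀ j r j′ r′ →
      1 ≤ j → j ≤ s → 1 ≤ r → r ≤ t → 1 ≤ j′ → j′ ≤ s → 1 ≤ r′ → r′ ≤ t →
      j′ ≤ j → r ≤ r′ → elt t j r ≢ elt t j′ r′ → Before π (elt t j r) (elt t j′ r′)

    positive-run⇒1≤s : ∀ s {a} → offset s + a ≤ s * t → 1 ≤ a → 1 ≤ s
    positive-run⇒1≤s zero    a≤0 1≤a = ⊥-elim (<⇒≱ 1≤a a≤0)
    positive-run⇒1≤s (suc s) _   _   = s≤s z≤n

    range1-suc : ∀ s → range1 (suc s * t) ≡ range1 (s * t) ++ segment (s * t) t
    range1-suc s = trans (cong range1 (+-comm t (s * t))) (range1-+ (s * t) t)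

    -- π starts with the entries offset s + 1, …, offset s + a of its top block, and no further one.
    record Run (s a : ℕ) (π : List ℕ) : Set where
      field
        a≤t        : a ≤ t
        a-bound    : offset s + a ≤ s * t
        rest       : List ℕ
        split      : π ≡ segment (offset s) a ++ rest
        rest-head  : Maybe.All (_≤ offset s) (head rest)
        rest-empty : a ≡ 0 → rest ≡ []

    runs : List ℕ
    runs = upTo (suc t)

    extend : ℕ → ℕ → List ℕ → List Bool → List ℕ
    extend s a π′ w = shuffle w (segment (s * t) t) (segment (offset s) a) ++ drop a π′

    ballotsWithLead : ℕ → ℕ → List (List Bool)
    ballotsWithLead b a = filter (λ w → leadingTrues w ≟ b) (ballots t a 0)

    extensions : ℕ → ℕ → ℕ → List ℕ → List (List ℕ)
    extensions s b a π′ = map (extend s a π′) (ballotsWithLead b a)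

    avoiders : ℕ → ℕ → List (List ℕ)
    extensionsFrom : ℕ → ℕ → ℕ → List (List ℕ)

    avoiders zero    zero    = [ [] ]
    avoiders zero    (suc _) = []
    avoiders (suc s) b       = concatMap (extensionsFrom s b) runs

    extensionsFrom s b a = concatMap (extensions s b a) (avoiders s a)

    module Extension {s a ρ w} (π′∈ : InEN2143 s t (segment (offset s) a ++ ρ)) (a≤t : a ≤ t)
                     (a-bound : offset s + a ≤ s * t) (ρ-head : Maybe.All (_≤ offset s) (head ρ))
                     (b : Ballot t a 0 w) where

      N : ℕ
      N = s * t
      T B σ π′ π : List ℕ
      T = segment (offset s) a
      B = segment N t
      σ = shuffle w B T
      π′ = T ++ ρ
      π = σ ++ ρ

      open Threshold N

      π′↭ : IsPerm N π′
      π′↭ = proj₁ (proj₁ π′∈)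

      π′-linear : RespectsOrder s π′
      π′-linear = proj₂ (proj₁ π′∈)

      ρ-small : All (_≤ N) ρ
      ρ-small = All.tabulate λ x∈ρ → proj₂ (∈-IsPerm⁻ π′↭ (∈-++⁺ʳ T x∈ρ))

      σ-small : filter (_≤? N) σ ≡ T
      σ-small = filter-small-shuffle b N (offset s) ≤-refl a-bound

      σ-large : filter (N <?_) σ ≡ B
      σ-large = filter-large-shuffle b N (offset s) ≤-refl a-bound

      B⊆σ : B ⊆ σ
      B⊆σ = subst (_⊆ σ) σ-large (Sublist.filter-⊆ (N <?_) σ)

      σ⊆π : σ ⊆ π
      σ⊆π = Sublist.++⁺ʳ ρ ⊆-refl

      π′⊆π : π′ ⊆ π
      π′⊆π = Sublist.++⁺ (subst (_⊆ σ) σ-small (Sublist.filter-⊆ (_≤? N) σ)) ⊆-refl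

      open PermutationReasoning

      π↭ : IsPerm (suc s * t) π
      π↭ = begin
        σ ++ ρ               ↭⟨ ++⁺ʳ ρ (shuffle-↭ b N (offset s)) ⟩
        (B ++ T) ++ ρ        ≡⟨ ++-assoc B T ρ ⟩
        B ++ π′              ↭⟨ ++⁺ˡ B π′↭ ⟩
        B ++ range1 N        ↭⟨ ++-comm B (range1 N) ⟩
        range1 N ++ B        ≡⟨ range1-suc s ⟨
        range1 (suc s * t)   ∎

      π-unique : Unique π
      π-unique = IsPerm-unique π↭

      large-before-small : ∀ r → 1 ≤ s → 1 ≤ r → r ≤ t → N + r ∷ offset s + r ∷ [] ⊆ π
      large-before-small r 1≤s 1≤r r≤t with r ≤? a
      ... | yes r≤a = ⊆-trans (shuffle-ballot b N (offset s) r 1≤r r≤a) σ⊆π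
      ... | no r≰a = Sublist.++⁺ (from∈ (Any-resp-⊆ B⊆σ N+r∈B)) (from∈ small∈ρ)
        where
        N+r∈B : N + r ∈ B
        N+r∈B = ∈-segment⁺ (m<m+n N 1≤r) (+-monoʳ-≤ N r≤t)
        small∈ρ : offset s + r ∈ ρ
        small∈ρ with ∈-++⁻ T (∈-IsPerm⁺ π′↭ (≤-trans 1≤r (m≤n+m r (offset s)))
                                           (≤-trans (+-monoʳ-≤ (offset s) r≤t) (≤-reflexive (offset-+-t s 1≤s))))
        ... | inj₁ ∈T = ⊥-elim (r≰a (+-cancelˡ-≤ (offset s) r a (proj₂ (∈-segment⁻ ∈T))))
        ... | inj₂ ∈ρ = ∈ρ

      π-linear : RespectsOrder (suc s) π
      π-linear j r j′ r′ 1≤j j≤ 1≤r r≤t 1≤j′ j′≤ 1≤r′ r′≤t j′≤j r≤r′ distinct with j ≤? s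
      ... | yes j≤s = ⊆⇒Before (⊆-trans (Before⇒⊆ (π′-linear j r j′ r′ 1≤j j≤s 1≤r r≤t
                                                   1≤j′ (≤-trans j′≤j j≤s) 1≤r′ r′≤t j′≤j r≤r′ distinct)) π′⊆π)
      ... | no j≰s with refl ← ≤-antisym j≤ (≰⇒> j≰s) | j′ ≤? s
      ...   | yes j′≤s = ⊆⇒Before (large-before-lower (≤-trans 1≤j′ j′≤s))
        where
        large-before-lower : 1 ≤ s → N + r ∷ elt t j′ r′ ∷ [] ⊆ π
        large-before-lower 1≤s with offset s + r ≟ elt t j′ r′
        ... | yes same = subst (λ y → N + r ∷ y ∷ [] ⊆ π) same (large-before-small r 1≤s 1≤r r≤t)
        ... | no different = Unique-⊆-trans π-unique (large-before-small r 1≤s 1≤r r≤t)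
                (⊆-trans (Before⇒⊆ (π′-linear s r j′ r′ 1≤s ≤-refl 1≤r r≤t 1≤j′ j′≤s 1≤r′ r′≤t
                                               j′≤s r≤r′ different)) π′⊆π)
      ...   | no j′≰s with refl ← ≤-antisym j′≤ (≰⇒> j′≰s) =
        ⊆⇒Before (⊆-trans (<⇒segment-⊆ (m<m+n N 1≤r) (+-monoʳ-< N r<r′) (+-monoʳ-≤ N r′≤t)) (⊆-trans B⊆σ σ⊆π))
        where
        r<r′ : r < r′
        r<r′ = ≤∧≢⇒< r≤r′ (distinct ∘′ cong (_+_ N))

      π-small : filter (_≤? N) π ≡ π′
      π-small = trans (filter-++ (_≤? N) σ ρ) (cong₂ _++_ σ-small (filter-all (_≤? N) ρ-small))

      π-avoids : Avoids2143 π
      π-avoids =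
        Avoids-threshold N π (subst Avoids2143 (sym π-small) (proj₂ π′∈)) large-increasing small-increasing
        where
        large-increasing : ∀ {u v} → u ∷ v ∷ [] ⊆ π → N < u → N < v → u < v
        large-increasing p N<u N<v =
          segment-⊆⇒< (subst (_ ⊆_) π-large (⊆-filter⁺ (N <?_) p (N<u ∷ N<v ∷ [])))
          where
          π-large : filter (N <?_) π ≡ B
          π-large = trans (filter-++ (N <?_) σ ρ)
            (trans (cong₂ _++_ σ-large (filter-none (N <?_) (All.map ≤⇒≯ ρ-small))) (++-identityʳ B))
        small-increasing : ∀ {u v c} → u ∷ v ∷ c ∷ [] ⊆ π → u ≤ N → v ≤ N → N < c → u < v
        small-increasing {u} {v} {c} p u≤N v≤N N<c =
          segment-⊆⇒< (subst (_ ⊆_) σ-small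
            (⊆-filter⁺ (_≤? N) (⊆-trans (refl ∷ refl ∷ _ ∷ʳ []) in-σ) (u≤N ∷ v≤N ∷ [])))
          where
          in-σ : u ∷ v ∷ c ∷ [] ⊆ σ
          in-σ = ⊆-++⁻ˡ (u ∷ v ∷ []) σ p λ c∈ρ → <⇒≱ N<c (All.lookup ρ-small c∈ρ)

      π∈ : InEN2143 (suc s) t π
      π∈ = (π↭ , π-linear) , π-avoids

      π-run : Run (suc s) (leadingTrues w) π
      π-run with ρ′ , split , ρ′-head ← shuffle-++-leadingTrues b N (offset s) ρ a-bound
                                          (Maybe.map (λ x≤ → ≤-trans x≤ (offset-≤ s)) ρ-head) = record
        { a≤t        = leadingTrues-≤ b
        ; a-bound    = ≤-trans (+-monoʳ-≤ N (leadingTrues-≤ b)) (≤-reflexive (+-comm N t))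
        ; rest       = ρ′
        ; split      = split
        ; rest-head  = ρ′-head
        ; rest-empty = λ lead≡0 → ⊥-elim (<⇒≱ (leadingTrues-pos b) (≤-reflexive lead≡0))
        }

      extend≡π : extend s a π′ w ≡ π
      extend≡π = cong (σ ++_) (drop-segment (offset s) a ρ)

    avoiders-sound : ∀ s a {π} → π ∈ avoiders s a → InEN2143 s t π × Run s a π
    avoiders-sound zero zero (here refl) =
      ((↭-refl , λ _ _ _ _ 1≤j j≤0 _ _ _ _ _ _ _ _ _ → ⊥-elim (<⇒≱ 1≤j j≤0)) , λ ()) ,
      record { a≤t = z≤n ; a-bound = z≤n ; rest = [] ; split = refl ; rest-head = Maybe.nothing
             ; rest-empty = λ _ → refl }
    avoiders-sound (suc s) b π∈
      with a , a∈ , π∈ ← ∈-concatMap⁻ runs π∈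
      with π′ , π′∈ , π∈ ← ∈-concatMap⁻ (avoiders s a) π∈
      with w , w∈ , refl ← ∈-map⁻ (extend s a π′) π∈
      with w∈ , refl ← ∈-filter⁻ (λ w → leadingTrues w ≟ b) w∈
      with π′-in , run ← avoiders-sound s a π′∈ =
      subst (λ π → InEN2143 (suc s) t π × Run (suc s) (leadingTrues w) π)
            (sym (trans (cong (λ π′ → extend s a π′ w) (Run.split run)) E.extend≡π)) (E.π∈ , E.π-run)
      where
      module E = Extension (subst (InEN2143 s t) (Run.split run) π′-in) (Run.a≤t run) (Run.a-bound run)
                           (Run.rest-head run) (∈-ballots⁻ t a 0 w∈)

    avoiders-run : ∀ s a {π} → π ∈ avoiders s a → Run s a π
    avoiders-run s a π∈ = proj₂ (avoiders-sound s a π∈)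

    module Restriction {s π} (π∈ : InEN2143 (suc s) t π) where

      N : ℕ
      N = s * t
      B π′ : List ℕ
      B = segment N t
      π′ = filter (_≤? N) π

      open Threshold N

      π↭ : IsPerm (suc s * t) π
      π↭ = proj₁ (proj₁ π∈)

      π-unique : Unique π
      π-unique = IsPerm-unique π↭

      π-linear : RespectsOrder (suc s) π
      π-linear = proj₂ (proj₁ π∈)

      range1-small : All (_≤ N) (range1 N)
      range1-small = All.tabulate λ x∈ → proj₂ (∈-IsPerm⁻ ↭-refl x∈)

      B-large : All (N <_) B
      B-large = All.tabulate λ x∈ → proj₁ (∈-segment⁻ x∈)

      open ≡-Reasoning

      small-range1 : filter (_≤? N) (range1 (suc s * t)) ≡ range1 N
      small-range1 = begin
        filter (_≤? N) (range1 (suc s * t))            ≡⟨ cong (filter (_≤? N)) (range1-suc s) ⟩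
        filter (_≤? N) (range1 N ++ B)                 ≡⟨ filter-++ (_≤? N) (range1 N) B ⟩
        filter (_≤? N) (range1 N) ++ filter (_≤? N) B
          ≡⟨ cong₂ _++_ (filter-all (_≤? N) range1-small) (filter-none (_≤? N) (All.map <⇒≱ B-large)) ⟩
        range1 N ++ []                                 ≡⟨ ++-identityʳ (range1 N) ⟩
        range1 N                                       ∎

      large-range1 : filter (N <?_) (range1 (suc s * t)) ≡ B
      large-range1 = begin
        filter (N <?_) (range1 (suc s * t))            ≡⟨ cong (filter (N <?_)) (range1-suc s) ⟩
        filter (N <?_) (range1 N ++ B)                 ≡⟨ filter-++ (N <?_) (range1 N) B ⟩
        filter (N <?_) (range1 N) ++ filter (N <?_) B
          ≡⟨ cong₂ _++_ (filter-none (N <?_) (All.map ≤⇒≯ range1-small)) (filter-all (N <?_) B-large) ⟩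
        B                                              ∎

      π′↭ : IsPerm N π′
      π′↭ = ↭-trans (filter-↭ (_≤? N) π↭) (↭-reflexive small-range1)

      π′-linear : RespectsOrder s π′
      π′-linear j r j′ r′ 1≤j j≤s 1≤r r≤t 1≤j′ j′≤s 1≤r′ r′≤t j′≤j r≤r′ distinct =
        ⊆⇒Before {π′} (⊆-filter⁺ (_≤? N)
          (Before⇒⊆ {π} (π-linear j r j′ r′ 1≤j (≤-trans j≤s (n≤1+n s)) 1≤r r≤t
                                  1≤j′ (≤-trans j′≤s (n≤1+n s)) 1≤r′ r′≤t j′≤j r≤r′ distinct))
          (elt-≤ 1≤j j≤s r≤t ∷ elt-≤ 1≤j′ j′≤s r′≤t ∷ []))

      π′∈ : InEN2143 s t π′
      π′∈ = (π′↭ , π′-linear) , Avoids-⊆ (Sublist.filter-⊆ (_≤? N) π) (proj₂ π∈)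

      large-pair : ∀ r r′ → 1 ≤ r → r < r′ → r′ ≤ t → N + r ∷ N + r′ ∷ [] ⊆ π
      large-pair r r′ 1≤r r<r′ r′≤t =
        Before⇒⊆ {π} (π-linear (suc s) r (suc s) r′ (s≤s z≤n) ≤-refl 1≤r (≤-trans (<⇒≤ r<r′) r′≤t)
                                (s≤s z≤n) ≤-refl (≤-trans 1≤r (<⇒≤ r<r′)) r′≤t
                                ≤-refl (<⇒≤ r<r′) (<⇒≢ r<r′ ∘′ +-cancelˡ-≡ N r r′))

      large-before-small : ∀ r → 1 ≤ s → 1 ≤ r → r ≤ t → N + r ∷ offset s + r ∷ [] ⊆ π
      large-before-small r 1≤s 1≤r r≤t =
        Before⇒⊆ {π} (π-linear (suc s) r s r (s≤s z≤n) ≤-refl 1≤r r≤t 1≤s (n≤1+n s) 1≤r r≤t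
                                (n≤1+n s) ≤-refl
                           λ eq → <-irrefl (sym (+-cancelʳ-≡ r N (offset s) eq)) (offset-< s 1≤s))

      B⊆π : B ⊆ π
      B⊆π = Unique-segment-⊆ N t π-unique (∈-IsPerm⁺ π↭ (s≤s z≤n) (s≤s (m≤n+m N t₀)))
              λ r 1≤r r<t → large-pair r (suc r) 1≤r ≤-refl r<t

      π-large : filter (N <?_) π ≡ B
      π-large = sym (≋⇒≡ (Sublist.to-≋ (sym length-eq) (⊆-filter⁺ (N <?_) B⊆π B-large)))
        where
        length-eq : length (filter (N <?_) π) ≡ length B
        length-eq = trans (↭-length (filter-↭ (N <?_) π↭)) (cong length large-range1)

      large-prefix : ∀ σ τ → π ≡ σ ++ τ → All (_≤ N) τ → filter (N <?_) σ ≡ B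
      large-prefix σ τ π≡ τ-small = begin
        filter (N <?_) σ                        ≡⟨ ++-identityʳ _ ⟨
        filter (N <?_) σ ++ []
          ≡⟨ cong (filter (N <?_) σ ++_) (filter-none (N <?_) (All.map ≤⇒≯ τ-small)) ⟨
        filter (N <?_) σ ++ filter (N <?_) τ    ≡⟨ filter-++ (N <?_) σ τ ⟨
        filter (N <?_) (σ ++ τ)                 ≡⟨ cong (filter (N <?_)) π≡ ⟨
        filter (N <?_) π                        ≡⟨ π-large ⟩
        B                                       ∎

      module _ {a} (run : Run s a π′) where

        open Run run
        T : List ℕ
        T = segment (offset s) a

        1≤s : 1 ≤ a → 1 ≤ s
        1≤s = positive-run⇒1≤s s a-bound

        -- If a large entry N + r followed the first entry x of rest, then x would precede N + t,
        -- closing a cycle through offset s + t when a = t and forming a 2143 otherwise.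
        after-rest-small : ∀ {x ρ′ e} → rest ≡ x ∷ ρ′ → x ≤ offset s → 1 ≤ a →
          x ∷ e ∷ [] ⊆ π → e ≤ N
        after-rest-small {x} {ρ′} {e} refl x≤ 1≤a x-e with e ≤? N
        ... | yes e≤N = e≤N
        ... | no e≰N = ⊥-elim (cycle-or-2143 (a ≟ t))
          where
          T-before-x : ∀ {m} → m ∈ T → m ∷ x ∷ [] ⊆ π
          T-before-x m∈T =
            ⊆-trans (subst (_ ⊆_) (sym split) (Sublist.++⁺ (from∈ m∈T) (refl ∷ minimum ρ′)))
                    (Sublist.filter-⊆ (_≤? N) π)
          r : ℕ
          r = e ∸ N
          N+r≡e : N + r ≡ e
          N+r≡e = m+[n∸m]≡n (<⇒≤ (≰⇒> e≰N))
          1≤r : 1 ≤ r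
          1≤r = m<n⇒0<n∸m (≰⇒> e≰N)
          r≤t : r ≤ t
          r≤t = ≤-trans (∸-monoˡ-≤ N (proj₂ (∈-IsPerm⁻ π↭ (Any-resp-⊆ x-e (there (here refl))))))
                        (≤-reflexive (m+n∸n≡m t N))
          x-N+t : x ∷ N + t ∷ [] ⊆ π
          x-N+t with r ≟ t
          ... | yes r≡t = subst (λ y → x ∷ y ∷ [] ⊆ π) (trans (sym N+r≡e) (cong (_+_ N) r≡t)) x-e
          ... | no r≢t = Unique-⊆-trans π-unique (subst (λ y → x ∷ y ∷ [] ⊆ π) (sym N+r≡e) x-e)
                                        (large-pair r t 1≤r (≤∧≢⇒< r≤t r≢t) ≤-refl)
          N+t-before-top : N + t ∷ offset s + t ∷ [] ⊆ π
          N+t-before-top = large-before-small t (1≤s 1≤a) (s≤s z≤n) ≤-refl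
          cycle-or-2143 : Dec (a ≡ t) → ⊥
          cycle-or-2143 (yes refl) =
            Unique-⊆-asym π-unique (T-before-x (∈-segment⁺ (m<m+n (offset s) 1≤a) ≤-refl))
                                   (Unique-⊆-trans π-unique x-N+t N+t-before-top)
          cycle-or-2143 (no a≢t) = Avoids⇒noOccurrence (proj₂ π∈) (occurrence
            (Unique-⊆-chain π-unique
              (T-before-x (∈-segment⁺ (m<m+n (offset s) ≤-refl) (+-monoʳ-≤ (offset s) 1≤a)))
              (Unique-⊆-chain π-unique x-N+t N+t-before-top))
            ( ≤-trans (s≤s x≤) (≤-reflexive (+-comm 1 (offset s)))
            , +-monoʳ-< (offset s) (<-≤-trans (s≤s 1≤a) (≤∧≢⇒< a≤t a≢t))
            , +-monoˡ-< t (offset-< s (1≤s 1≤a)) ))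

        rest-head∈π : ∀ {x ρ′} → rest ≡ x ∷ ρ′ → x ∈ π
        rest-head∈π rest≡ = Any-resp-⊆ (Sublist.filter-⊆ (_≤? N) π)
          (subst (_ ∈_) (sym (trans split (cong (T ++_) rest≡))) (∈-++⁺ʳ T (here refl)))

        decompose : ∀ ρ → rest ≡ ρ →
          ∃ λ σ → π ≡ σ ++ ρ × filter (_≤? N) σ ≡ T × filter (N <?_) σ ≡ B
        decompose [] rest≡[] = π , sym (++-identityʳ π) , π-small , π-large
          where
          π-small : filter (_≤? N) π ≡ T
          π-small = trans split (trans (cong (T ++_) rest≡[]) (++-identityʳ T))
        decompose (x ∷ ρ′) rest≡ with σ , τ , π≡ ← ∈-∃++ (rest-head∈π rest≡) =
          σ , trans π≡ (cong (λ τ → σ ++ x ∷ τ) τ≡ρ′) , σ-small , σ-large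
          where
          x≤ : x ≤ offset s
          x≤ = Maybe.drop-just (subst (λ ρ → Maybe.All (_≤ offset s) (head ρ)) rest≡ rest-head)
          1≤a : 1 ≤ a
          1≤a = n≢0⇒n>0 λ a≡0 → case (trans (sym rest≡) (rest-empty a≡0)) of λ ()
          σxτ-unique : Unique (σ ++ x ∷ τ)
          σxτ-unique = subst Unique π≡ π-unique
          xτ-small : All (_≤ N) (x ∷ τ)
          xτ-small = ≤-trans x≤ (offset-≤ s) ∷ All.tabulate λ e∈τ →
            after-rest-small rest≡ x≤ 1≤a (subst (_ ⊆_) (sym π≡) (Sublist.++⁺ˡ σ (refl ∷ from∈ e∈τ)))
          cancelled : filter (_≤? N) σ ≡ T × τ ≡ ρ′
          cancelled = ++-∷-cancel (filter (_≤? N) σ) τ T ρ′ (begin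
            filter (_≤? N) σ ++ x ∷ τ
              ≡⟨ cong (filter (_≤? N) σ ++_) (filter-all (_≤? N) xτ-small) ⟨
            filter (_≤? N) σ ++ filter (_≤? N) (x ∷ τ)  ≡⟨ filter-++ (_≤? N) σ (x ∷ τ) ⟨
            filter (_≤? N) (σ ++ x ∷ τ)                 ≡⟨ cong (filter (_≤? N)) π≡ ⟨
            π′                                          ≡⟨ split ⟩
            T ++ rest                                   ≡⟨ cong (T ++_) rest≡ ⟩
            T ++ x ∷ ρ′                                 ∎)
            (λ x∈ → Unique-++⇒∉ σ σxτ-unique (proj₁ (∈-filter⁻ (_≤? N) x∈)) (here refl))
            (λ x∈T → <⇒≱ (proj₁ (∈-segment⁻ x∈T)) x≤)
          σ-small : filter (_≤? N) σ ≡ T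
          σ-small = proj₁ cancelled
          τ≡ρ′ : τ ≡ ρ′
          τ≡ρ′ = proj₂ cancelled
          σ-large : filter (N <?_) σ ≡ B
          σ-large = large-prefix σ (x ∷ τ) π≡ xτ-small

        large-before-small-in : ∀ σ → π ≡ σ ++ rest → filter (_≤? N) σ ≡ T →
          ∀ k → 1 ≤ k → 0 + k ≤ a → N + k ∷ offset s + (0 + k) ∷ [] ⊆ σ
        large-before-small-in σ π≡ σ-small k 1≤k k≤a =
          ⊆-++⁻ˡ [ N + k ] σ
            (subst (_ ⊆_) π≡ (large-before-small k (1≤s (≤-trans 1≤k k≤a)) 1≤k (≤-trans k≤a a≤t)))
            (Unique-++⇒∉ σ (subst Unique π≡ π-unique) small∈σ)
          where
          small∈σ : offset s + k ∈ σ
          small∈σ = Any-resp-⊆ (Sublist.filter-⊆ (_≤? N) σ)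
            (subst (_ ∈_) (sym σ-small) (∈-segment⁺ (m<m+n (offset s) 1≤k) (+-monoʳ-≤ (offset s) k≤a)))

        π-extends : ∃ λ w → Ballot t a 0 w × π ≡ extend s a π′ w
        π-extends
          with σ , π≡ , σ-small , σ-large ← decompose rest refl
          with w , b , σ≡ ← shuffle-complete t a 0 N (offset s) σ ≤-refl a-bound
                              (Unique-++⁻ˡ σ (subst Unique π≡ π-unique)) σ-small σ-large
                              (large-before-small-in σ π≡ σ-small) =
          w , b , trans π≡ (cong₂ _++_ (sym σ≡) (sym rest≡drop))
          where
          rest≡drop : drop a π′ ≡ rest
          rest≡drop = trans (cong (drop a) split) (drop-segment (offset s) a rest)

    avoiders-complete : ∀ s {π} → InEN2143 s t π → ∃ λ a → π ∈ avoiders s a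
    avoiders-complete zero    π∈ with refl ← ↭-empty-inv (proj₁ (proj₁ π∈)) = 0 , here refl
    avoiders-complete (suc s) π∈
      with a , π′∈ ← avoiders-complete s (Restriction.π′∈ π∈)
      with run ← avoiders-run s a π′∈
      with w , b , π≡ ← Restriction.π-extends π∈ run =
      leadingTrues w ,
      ∈-concatMap⁺ {f = extensionsFrom s (leadingTrues w)} (∈-upTo⁺ (s≤s (Run.a≤t run)))
        (∈-concatMap⁺ {f = extensions s (leadingTrues w) a} π′∈
          (subst (_∈ extensions s (leadingTrues w) a (Restriction.π′ π∈)) (sym π≡)
            (∈-map⁺ (extend s a _)
              (∈-filter⁺ (λ w′ → leadingTrues w′ ≟ leadingTrues w) (∈-ballots⁺ b) refl))))

    run-unique : ∀ {s a a′ π} → Run s a π → Run s a′ π → a ≡ a′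
    run-unique {s} run run′ =
      segment-++-injective (offset s) _ _ ≤-refl (Run.rest-head run) (Run.rest-head run′)
                           (trans (sym (Run.split run)) (Run.split run′))

    module _ (s a : ℕ) {π′} (π′∈ : π′ ∈ avoiders s a) where

      private
        run : Run s a π′
        run = avoiders-run s a π′∈

        module E {w} (b : Ballot t a 0 w) =
          Extension (subst (InEN2143 s t) (Run.split run) (proj₁ (avoiders-sound s a π′∈)))
                    (Run.a≤t run) (Run.a-bound run) (Run.rest-head run) b

        extend-small : ∀ {w} → Ballot t a 0 w → filter (_≤? s * t) (extend s a π′ w) ≡ π′
        extend-small {w} b = begin
          filter (_≤? s * t) (extend s a π′ w)
            ≡⟨ cong (λ π′ → filter (_≤? s * t) (extend s a π′ w)) (Run.split run) ⟩
          filter (_≤? s * t) (extend s a (E.π′ b) w) ≡⟨ cong (filter (_≤? s * t)) (E.extend≡π b) ⟩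
          filter (_≤? s * t) (E.π b)                ≡⟨ E.π-small b ⟩
          E.π′ b                                    ≡⟨ Run.split run ⟨
          π′                                        ∎
          where open ≡-Reasoning

      extend-injective : ∀ {w w′} → Ballot t a 0 w → Ballot t a 0 w′ →
        extend s a π′ w ≡ extend s a π′ w′ → w ≡ w′
      extend-injective b b′ eq =
        Threshold.shuffle-injective (s * t) b b′ (s * t) (offset s) ≤-refl (Run.a-bound run) (++-cancelʳ _ _ _ eq)

      extensions-small : ∀ {b π} → π ∈ extensions s b a π′ → filter (_≤? s * t) π ≡ π′
      extensions-small π∈ with w , w∈ , refl ← ∈-map⁻ (extend s a π′) π∈ =
        extend-small (∈-ballots⁻ t a 0 (proj₁ (∈-filter⁻ (λ w → leadingTrues w ≟ _) w∈)))

    avoiders-unique : ∀ s a → Unique (avoiders s a)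
    avoiders-unique zero    zero    = [] ∷ []
    avoiders-unique zero    (suc a) = []
    avoiders-unique (suc s) b = concatMap-unique (Unique.upTo⁺ (suc t)) from-unique from-disjoint
      where
      ballot : ∀ {a w} → w ∈ ballotsWithLead b a → Ballot t a 0 w
      ballot {a} w∈ = ∈-ballots⁻ t a 0 (proj₁ (∈-filter⁻ (λ w → leadingTrues w ≟ b) w∈))
      same-restriction : ∀ {a a′ π′ π″ π} → (π′∈ : π′ ∈ avoiders s a) (π″∈ : π″ ∈ avoiders s a′) →
        π ∈ extensions s b a π′ → π ∈ extensions s b a′ π″ → π′ ≡ π″
      same-restriction {a} {a′} π′∈ π″∈ π∈ π∈′ =
        trans (sym (extensions-small s a π′∈ π∈)) (extensions-small s a′ π″∈ π∈′)
      from-unique : ∀ {a} → a ∈ runs → Unique (extensionsFrom s b a)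
      from-unique {a} _ = concatMap-unique (avoiders-unique s a)
        (λ π′∈ → map-unique (Unique.filter⁺ _ (ballots-unique t a 0))
                   λ w∈ w′∈ → extend-injective s a π′∈ (ballot w∈) (ballot w′∈))
        same-restriction
      from-disjoint : ∀ {a a′ π} → a ∈ runs → a′ ∈ runs →
        π ∈ extensionsFrom s b a → π ∈ extensionsFrom s b a′ → a ≡ a′
      from-disjoint {a} {a′} _ _ π∈ π∈′ =
        let π′ , π′∈ , π∈₁ = ∈-concatMap⁻ {f = extensions s b a} (avoiders s a) π∈
            π″ , π″∈ , π∈₂ = ∈-concatMap⁻ {f = extensions s b a′} (avoiders s a′) π∈′
        in run-unique (avoiders-run s a π′∈)
                      (subst (Run s a′) (sym (same-restriction π′∈ π″∈ π∈₁ π∈₂)) (avoiders-run s a′ π″∈))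

    allAvoiders : ℕ → List (List ℕ)
    allAvoiders s = concatMap (avoiders s) runs

    allAvoiders-card : ∀ s → CardEN2143 s t (length (allAvoiders s))
    allAvoiders-card s = allAvoiders s , unique , (λ π → mk⇔ sound complete) , refl
      where
      unique : Unique (allAvoiders s)
      unique = concatMap-unique (Unique.upTo⁺ (suc t)) (λ {a} _ → avoiders-unique s a)
        λ {a} {a′} _ _ π∈ π∈′ → run-unique (avoiders-run s a π∈) (avoiders-run s a′ π∈′)
      sound : ∀ {π} → π ∈ allAvoiders s → InEN2143 s t π
      sound π∈ with a , _ , π∈ ← ∈-concatMap⁻ {f = avoiders s} runs π∈ = proj₁ (avoiders-sound s a π∈)
      complete : ∀ {π} → InEN2143 s t π → π ∈ allAvoiders s
      complete π∈ with a , π∈ ← avoiders-complete s π∈ =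
        ∈-concatMap⁺ {f = avoiders s} (∈-upTo⁺ (s≤s (Run.a≤t (avoiders-run s a π∈)))) π∈

    count : ℕ → ℕ → ℕ
    count s a = length (avoiders s a)

    transfer : ℕ → ℕ → ℕ
    transfer a b = length (ballotsWithLead b a)

    count-suc : ∀ s b → count (suc s) b ≡ sum (map (λ a → count s a * transfer a b) runs)
    count-suc s b = trans (length-concatMap {f = extensionsFrom s b} runs) (cong sum (map-cong from-run runs))
      where
      from-run : ∀ a → length (extensionsFrom s b a) ≡ count s a * transfer a b
      from-run a = trans (length-concatMap {f = extensions s b a} (avoiders s a))
        (trans (cong sum (map-cong (λ π′ → length-map (extend s a π′) (ballotsWithLead b a)) (avoiders s a)))
               (sum-map-const (avoiders s a) (transfer a b)))

    length-allAvoiders : ∀ s → length (allAvoiders s) ≡ sum (map (count s) runs)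
    length-allAvoiders s = length-concatMap {f = avoiders s} runs

    -- Every linear extension of EN_{s+1,t} starts with an entry of its top block.
    avoiders-suc-zero-empty : ∀ s {π} → π ∈ avoiders (suc s) 0 → ⊥
    avoiders-suc-zero-empty s {π} π∈ = 1∉[] (subst (1 ∈_) π≡[] (∈-IsPerm⁺ π↭ ≤-refl (s≤s z≤n)))
      where
      sound : InEN2143 (suc s) t π × Run (suc s) 0 π
      sound = avoiders-sound (suc s) 0 π∈
      π↭ : IsPerm (suc s * t) π
      π↭ = proj₁ (proj₁ (proj₁ sound))
      π≡[] : π ≡ []
      π≡[] = trans (Run.split (proj₂ sound)) (Run.rest-empty (proj₂ sound) refl)
      1∉[] : 1 ∉ []
      1∉[] ()

    count-suc-zero : ∀ s → count (suc s) 0 ≡ 0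
    count-suc-zero s = no-member⇒length≡0 (avoiders (suc s) 0) (avoiders-suc-zero-empty s)


-- Unfolded, count-suc reads Σₐ count s a * transfer a b, with the numbers transfer a b evaluated.
module Counting where

  open import Data.Nat using (ℕ; zero; suc; _+_; _*_; _∸_; _^_)
  open import Data.Nat.Properties using (+-comm; *-suc)
  open import Data.Nat.Tactic.RingSolver using (solve-∀; solve)
  open import Data.Integer as ℤ using (+_; -1ℤ)
  open import Data.Integer.Properties using (pos-+; pos-*)
  import Data.Integer.Tactic.RingSolver as ℤSolver
  open import Data.List using ([]; _∷_; length)
  open import Data.Product using (_×_; _,_; proj₁; proj₂)
  open import Function using (_∘′_)
  open import Relation.Binary.PropositionalEquality
    using (_≡_; refl; sym; trans; cong; cong₂; module ≡-Reasoning)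
  open Enumeration using (module Extensions)

  fib-+3 : ∀ n → fib (3 + n) ≡ fib n + 2 * fib (suc n)
  fib-+3 n = identity (fib n) (fib (suc n))
    where
    identity : ∀ a b → (b + a) + b ≡ a + 2 * b
    identity = solve-∀

  fib-+4 : ∀ n → fib (4 + n) ≡ 2 * fib n + 3 * fib (suc n)
  fib-+4 n = identity (fib n) (fib (suc n))
    where
    identity : ∀ a b → ((b + a) + b) + (b + a) ≡ 2 * a + 3 * b
    identity = solve-∀

  module Width1 where
    open Extensions 0
    open ≡-Reasoning

    total : ∀ s → length (allAvoiders s) ≡ 1
    total zero    = refl
    total (suc s) = begin
      length (allAvoiders (suc s))                     ≡⟨ length-allAvoiders (suc s) ⟩
      count (suc s) 0 + (count (suc s) 1 + 0)
        ≡⟨ cong₂ (λ x y → x + (y + 0)) (count-suc-zero s) (count-suc s 1) ⟩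
      0 + ((count s 0 * 1 + (count s 1 * 1 + 0)) + 0)  ≡⟨ step (count s 0) (count s 1) ⟩
      count s 0 + (count s 1 + 0)                      ≡⟨ length-allAvoiders s ⟨
      length (allAvoiders s)                           ≡⟨ total s ⟩
      1                                                ∎
      where
      step : ∀ c₀ c₁ → 0 + ((c₀ * 1 + (c₁ * 1 + 0)) + 0) ≡ c₀ + (c₁ + 0)
      step = solve-∀

  module Width2 where
    open Extensions 1
    open ≡-Reasoning

    total : ∀ k → length (allAvoiders (suc k)) ≡ 2 ^ k
    total zero    = refl
    total (suc k) = begin
      length (allAvoiders (suc (suc k)))
        ≡⟨ length-allAvoiders (suc (suc k)) ⟩
      count (suc (suc k)) 0 + (count (suc (suc k)) 1 + (count (suc (suc k)) 2 + 0))
        ≡⟨ cong₂ _+_ (count-suc-zero (suc k))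
                     (cong₂ (λ x y → x + (y + 0)) (count-suc (suc k) 1) (count-suc (suc k) 2)) ⟩
      0 + ((c 0 * 0 + (c 1 * 1 + (c 2 * 1 + 0))) + ((c 0 * 1 + (c 1 * 1 + (c 2 * 1 + 0))) + 0))
        ≡⟨ step (c 0) (c 1) (c 2) (count-suc-zero k) ⟩
      2 * (c 0 + (c 1 + (c 2 + 0)))
        ≡⟨ cong (2 *_) (trans (sym (length-allAvoiders (suc k))) (total k)) ⟩
      2 ^ suc k
        ∎
      where
      c : ℕ → ℕ
      c = count (suc k)
      step : ∀ c₀ c₁ c₂ → c₀ ≡ 0 →
        0 + ((c₀ * 0 + (c₁ * 1 + (c₂ * 1 + 0))) + ((c₀ * 1 + (c₁ * 1 + (c₂ * 1 + 0))) + 0))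
          ≡ 2 * (c₀ + (c₁ + (c₂ + 0)))
      step c₀ c₁ c₂ refl = solve (c₁ ∷ c₂ ∷ [])

  module Width3 where
    open Extensions 2
    open ≡-Reasoning

    -- Columns 1 and 2 of the transfer matrix coincide, so both sides unfold to the same sum.
    count-suc-two : ∀ s → count (suc s) 2 ≡ count (suc s) 1
    count-suc-two s = trans (count-suc s 2) (sym (count-suc s 1))

    counts : ∀ k → count (suc k) 1 ≡ fib (3 * k) × count (suc k) 1 + count (suc k) 3 ≡ fib (suc (3 * k))
    counts zero    = refl , refl
    counts (suc k) with F≡ , G≡ ← counts k = c₁-suc , c₁+c₃-suc
      where
      c : ℕ → ℕ
      c = count (suc k)
      c₁-suc : count (suc (suc k)) 1 ≡ fib (3 * suc k)
      c₁-suc = begin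
        count (suc (suc k)) 1                            ≡⟨ count-suc (suc k) 1 ⟩
        c 0 * 0 + (c 1 * 1 + (c 2 * 2 + (c 3 * 2 + 0)))  ≡⟨ step (c 0) (c 1) (c 2) (c 3) (count-suc-two k) ⟩
        c 1 + 2 * (c 1 + c 3)                            ≡⟨ cong₂ (λ F G → F + 2 * G) F≡ G≡ ⟩
        fib (3 * k) + 2 * fib (suc (3 * k))              ≡⟨ fib-+3 (3 * k) ⟨
        fib (3 + 3 * k)                                  ≡⟨ cong fib (*-suc 3 k) ⟨
        fib (3 * suc k)                                  ∎
        where
        step : ∀ c₀ c₁ c₂ c₃ → c₂ ≡ c₁ →
          c₀ * 0 + (c₁ * 1 + (c₂ * 2 + (c₃ * 2 + 0))) ≡ c₁ + 2 * (c₁ + c₃)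
        step c₀ c₁ c₂ c₃ refl = solve (c₀ ∷ c₁ ∷ c₃ ∷ [])
      c₁+c₃-suc : count (suc (suc k)) 1 + count (suc (suc k)) 3 ≡ fib (suc (3 * suc k))
      c₁+c₃-suc = begin
        count (suc (suc k)) 1 + count (suc (suc k)) 3
          ≡⟨ cong₂ _+_ (count-suc (suc k) 1) (count-suc (suc k) 3) ⟩
        (c 0 * 0 + (c 1 * 1 + (c 2 * 2 + (c 3 * 2 + 0)))) + (c 0 * 1 + (c 1 * 1 + (c 2 * 1 + (c 3 * 1 + 0))))
          ≡⟨ step (c 0) (c 1) (c 2) (c 3) (count-suc-zero k) (count-suc-two k) ⟩
        2 * c 1 + 3 * (c 1 + c 3)                        ≡⟨ cong₂ (λ F G → 2 * F + 3 * G) F≡ G≡ ⟩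
        2 * fib (3 * k) + 3 * fib (suc (3 * k))          ≡⟨ fib-+4 (3 * k) ⟨
        fib (4 + 3 * k)                                  ≡⟨ cong (fib ∘′ suc) (*-suc 3 k) ⟨
        fib (suc (3 * suc k))                            ∎
        where
        step : ∀ c₀ c₁ c₂ c₃ → c₀ ≡ 0 → c₂ ≡ c₁ →
          (c₀ * 0 + (c₁ * 1 + (c₂ * 2 + (c₃ * 2 + 0)))) + (c₀ * 1 + (c₁ * 1 + (c₂ * 1 + (c₃ * 1 + 0))))
            ≡ 2 * c₁ + 3 * (c₁ + c₃)
        step c₀ c₁ c₂ c₃ refl refl = solve (c₁ ∷ c₃ ∷ [])

    total : ∀ k → length (allAvoiders (suc k)) ≡ fib (3 * suc k ∸ 1)
    total k = begin
      length (allAvoiders (suc k))     ≡⟨ length-allAvoiders (suc k) ⟩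
      c 0 + (c 1 + (c 2 + (c 3 + 0)))  ≡⟨ step (c 0) (c 1) (c 2) (c 3) (count-suc-zero k) (count-suc-two k) ⟩
      c 1 + (c 1 + c 3)                ≡⟨ cong₂ _+_ (proj₁ (counts k)) (proj₂ (counts k)) ⟩
      fib (3 * k) + fib (suc (3 * k))  ≡⟨ +-comm (fib (3 * k)) _ ⟩
      fib (2 + 3 * k)                  ≡⟨ cong (λ n → fib (n ∸ 1)) (*-suc 3 k) ⟨
      fib (3 * suc k ∸ 1)              ∎
      where
      c : ℕ → ℕ
      c = count (suc k)
      step : ∀ c₀ c₁ c₂ c₃ → c₀ ≡ 0 → c₂ ≡ c₁ → c₀ + (c₁ + (c₂ + (c₃ + 0))) ≡ c₁ + (c₁ + c₃)
      step c₀ c₁ c₂ c₃ refl refl = solve (c₁ ∷ c₃ ∷ [])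

  module Width4 where
    open Extensions 3
    open ≡-Reasoning

    count-suc-two : ∀ s → count (suc s) 2 ≡ count (suc s) 1
    count-suc-two s = trans (count-suc s 2) (sym (count-suc s 1))

    X Y : ℕ → ℕ
    X k = count (suc k) 1
    Y k = count (suc k) 3 + count (suc k) 4

    X-suc : ∀ k → X (suc k) ≡ 4 * X k + 5 * Y k
    X-suc k = trans (count-suc (suc k) 1) (step (c 0) (c 1) (c 2) (c 3) (c 4) (count-suc-two k))
      where
      c : ℕ → ℕ
      c = count (suc k)
      step : ∀ c₀ c₁ c₂ c₃ c₄ → c₂ ≡ c₁ →
        c₀ * 0 + (c₁ * 1 + (c₂ * 3 + (c₃ * 5 + (c₄ * 5 + 0)))) ≡ 4 * c₁ + 5 * (c₃ + c₄)
      step c₀ c₁ c₂ c₃ c₄ refl = solve (c₀ ∷ c₁ ∷ c₃ ∷ c₄ ∷ [])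

    Y-suc : ∀ k → Y (suc k) ≡ 5 * X k + 4 * Y k
    Y-suc k = trans (cong₂ _+_ (count-suc (suc k) 3) (count-suc (suc k) 4))
                    (step (c 0) (c 1) (c 2) (c 3) (c 4) (count-suc-zero k) (count-suc-two k))
      where
      c : ℕ → ℕ
      c = count (suc k)
      step : ∀ c₀ c₁ c₂ c₃ c₄ → c₀ ≡ 0 → c₂ ≡ c₁ →
        (c₀ * 0 + (c₁ * 1 + (c₂ * 2 + (c₃ * 3 + (c₄ * 3 + 0))))) +
        (c₀ * 1 + (c₁ * 1 + (c₂ * 1 + (c₃ * 1 + (c₄ * 1 + 0))))) ≡ 5 * c₁ + 4 * (c₃ + c₄)
      step c₀ c₁ c₂ c₃ c₄ refl refl = solve (c₁ ∷ c₃ ∷ c₄ ∷ [])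

    X+Y : ∀ k → X k + Y k ≡ 9 ^ k
    X+Y zero    = refl
    X+Y (suc k) = begin
      X (suc k) + Y (suc k)                      ≡⟨ cong₂ _+_ (X-suc k) (Y-suc k) ⟩
      (4 * X k + 5 * Y k) + (5 * X k + 4 * Y k)  ≡⟨ step (X k) (Y k) ⟩
      9 * (X k + Y k)                            ≡⟨ cong (9 *_) (X+Y k) ⟩
      9 ^ suc k                                  ∎
      where
      step : ∀ x y → (4 * x + 5 * y) + (5 * x + 4 * y) ≡ 9 * (x + y)
      step = solve-∀

    private
      pos-linear : ∀ a b m n → + (a * m + b * n) ≡ + a ℤ.* + m ℤ.+ + b ℤ.* + n
      pos-linear a b m n = trans (pos-+ (a * m) (b * n)) (cong₂ ℤ._+_ (pos-* a m) (pos-* b n))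

    Y-X : ∀ k → + Y k ≡ + X k ℤ.+ -1ℤ ℤ.^ k
    Y-X zero    = refl
    Y-X (suc k) = begin
      + Y (suc k)                                              ≡⟨ cong +_ (Y-suc k) ⟩
      + (5 * X k + 4 * Y k)                                    ≡⟨ pos-linear 5 4 (X k) (Y k) ⟩
      + 5 ℤ.* + X k ℤ.+ + 4 ℤ.* + Y k                          ≡⟨ step (+ X k) (+ Y k) (-1ℤ ℤ.^ k) (Y-X k) ⟩
      + 4 ℤ.* + X k ℤ.+ + 5 ℤ.* + Y k ℤ.+ -1ℤ ℤ.^ suc k        ≡⟨ cong (ℤ._+ -1ℤ ℤ.^ suc k) (pos-linear 4 5 (X k) (Y k)) ⟨
      + (4 * X k + 5 * Y k) ℤ.+ -1ℤ ℤ.^ suc k                  ≡⟨ cong (λ n → + n ℤ.+ -1ℤ ℤ.^ suc k) (X-suc k) ⟨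
      + X (suc k) ℤ.+ -1ℤ ℤ.^ suc k                            ∎
      where
      step : ∀ x y e → y ≡ x ℤ.+ e → + 5 ℤ.* x ℤ.+ + 4 ℤ.* y ≡ + 4 ℤ.* x ℤ.+ + 5 ℤ.* y ℤ.+ -1ℤ ℤ.* e
      step x _ e refl = ℤSolver.solve (x ∷ e ∷ [])

    total : ∀ k → + (2 * length (allAvoiders (suc k))) ≡ + (3 * 9 ^ k) ℤ.+ -1ℤ ℤ.^ suc k
    total k = begin
      + (2 * length (allAvoiders (suc k)))               ≡⟨ cong (λ n → + (2 * n)) (length-allAvoiders (suc k)) ⟩
      + (2 * (c 0 + (c 1 + (c 2 + (c 3 + (c 4 + 0))))))
        ≡⟨ cong +_ (doubled (c 0) (c 1) (c 2) (c 3) (c 4) (count-suc-zero k) (count-suc-two k)) ⟩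
      + (4 * X k + 2 * Y k)                              ≡⟨ pos-linear 4 2 (X k) (Y k) ⟩
      + 4 ℤ.* + X k ℤ.+ + 2 ℤ.* + Y k                    ≡⟨ step (+ X k) (+ Y k) (-1ℤ ℤ.^ k) (Y-X k) ⟩
      + 3 ℤ.* (+ X k ℤ.+ + Y k) ℤ.+ -1ℤ ℤ.^ suc k        ≡⟨ cong (λ z → + 3 ℤ.* z ℤ.+ -1ℤ ℤ.^ suc k) X+Y≡ ⟩
      + 3 ℤ.* + (9 ^ k) ℤ.+ -1ℤ ℤ.^ suc k                ≡⟨ cong (ℤ._+ -1ℤ ℤ.^ suc k) (pos-* 3 (9 ^ k)) ⟨
      + (3 * 9 ^ k) ℤ.+ -1ℤ ℤ.^ suc k                    ∎
      where
      c : ℕ → ℕ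
      c = count (suc k)
      X+Y≡ : + X k ℤ.+ + Y k ≡ + (9 ^ k)
      X+Y≡ = trans (sym (pos-+ (X k) (Y k))) (cong +_ (X+Y k))
      doubled : ∀ c₀ c₁ c₂ c₃ c₄ → c₀ ≡ 0 → c₂ ≡ c₁ →
        2 * (c₀ + (c₁ + (c₂ + (c₃ + (c₄ + 0))))) ≡ 4 * c₁ + 2 * (c₃ + c₄)
      doubled c₀ c₁ c₂ c₃ c₄ refl refl = solve (c₁ ∷ c₃ ∷ c₄ ∷ [])
      step : ∀ x y e → y ≡ x ℤ.+ e → + 4 ℤ.* x ℤ.+ + 2 ℤ.* y ≡ + 3 ℤ.* (x ℤ.+ y) ℤ.+ -1ℤ ℤ.* e
      step x _ e refl = ℤSolver.solve (x ∷ e ∷ [])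

open import Data.Nat using (ℕ; suc; _≤_; _*_; _∸_; _^_)
open import Data.Integer using (ℤ; +_; -1ℤ; _+_)
import Data.Integer as ℤ
open import Data.Product using (_×_; Σ; _,_)
open import Relation.Binary.PropositionalEquality using (_≡_; subst)
open Enumeration.Extensions using (allAvoiders-card)
open Counting

theorem5p9 : (s : ℕ) → 1 ≤ s →
    CardEN2143 s 1 1 ×
    CardEN2143 s 2 (2 ^ (s ∸ 1)) ×
    CardEN2143 s 3 (fib (3 * s ∸ 1)) ×
    Σ ℕ (λ N → CardEN2143 s 4 N × (+ (2 * N) ≡ + (3 * 9 ^ (s ∸ 1)) + (-1ℤ ℤ.^ s)))
theorem5p9 s@(suc k) _ =
  subst (CardEN2143 s 1) (Width1.total s) (allAvoiders-card 0 s) ,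
  subst (CardEN2143 s 2) (Width2.total k) (allAvoiders-card 1 s) ,
  subst (CardEN2143 s 3) (Width3.total k) (allAvoiders-card 2 s) ,
  (_ , allAvoiders-card 3 s , Width4.total k)
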